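{- Every word-representable co-bipartite graph has representation number at most $3$; that is, for every word-representable co-bipartite graph $G$ there exists a word $w$ in which every vertex of $G$ occurs exactly $3$ times and which represents $G$ (hence $G$ is $k$-representable for some $k\le 3$).
   Context: A graph $G=(V,E)$ is word-representable if there is a word $w$ over the alphabet $V$ such that for distinct $x,y\in V$, the letters $x$ and $y$ alternate in $w$ (the subword of $w$ consisting only of $x$'s and $y$'s is $xyxy\cdots$ or $yxyx\cdots$, of odd or even length) if and only if $xy\in E$; such $w$ represents $G$ and contains each vertex at least once. A word is $k$-uniform if every letter occurs exactly $k$ times; $G$ is $k$-representable if some $k$-uniform word represents it. The representation number of a word-representable graph is the least $k$ such that it is $k$-representable. A graph is co-bipartite if its complement is bipartite, i.e. its vertex set can be partitioned into two cliques. -}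

module Defs where

open import Data.Nat using (ℕ)
open import Data.Fin using (Fin)
open import Data.Fin.Properties using (_≟_)
open import Data.List using (List; []; _∷_; filter; length)
open import Data.List.Membership.Propositional using (_∈_)
open import Data.Sum using (_⊎_)
open import Data.Product using (_×_; Σ)
open import Data.Bool using (Bool)
open import Relation.Nullary using (¬_)
open import Relation.Nullary.Decidable using (_⊎-dec_)
open import Relation.Binary.PropositionalEquality using (_≡_; _≢_)
open import Function.Bundles using (_⇔_)

record Graph (n : ℕ) : Set₁ where
  field
    Adj     : Fin n → Fin n → Set
    irrefl  : ∀ x → ¬ Adj x x
    sym     : ∀ x y → Adj x y → Adj y x
open Graph public

Word : ℕ → Set
Word n = List (Fin n)

restrict : ∀ {n} → Fin n → Fin n → Word n → Word n
restrict x y w = filter (λ z → (z ≟ x) ⊎-dec (z ≟ y)) w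

data NoAdjRepeat {A : Set} : List A → Set where
  nil  : NoAdjRepeat []
  one  : ∀ a → NoAdjRepeat (a ∷ [])
  cons : ∀ a b l → a ≢ b → NoAdjRepeat (b ∷ l) → NoAdjRepeat (a ∷ b ∷ l)

-- x and y alternate in w: the subword on {x,y} is xyxy... or yxyx...
-- (for x ≢ y, this is exactly "no two consecutive letters equal").
Alternate : ∀ {n} → Fin n → Fin n → Word n → Set
Alternate x y w = NoAdjRepeat (restrict x y w)

Represents : ∀ {n} → Word n → Graph n → Set
Represents {n} w G =
  (∀ (v : Fin n) → v ∈ w) ×
  (∀ (x y : Fin n) → x ≢ y → (Alternate x y w ⇔ Adj G x y))

WordRepresentable : ∀ {n} → Graph n → Set
WordRepresentable {n} G = Σ (Word n) (λ w → Represents w G)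

count : ∀ {n} → Fin n → Word n → ℕ
count x w = length (filter (λ z → z ≟ x) w)

Uniform : ∀ {n} → ℕ → Word n → Set
Uniform {n} k w = ∀ (v : Fin n) → count v w ≡ k

KRepresentable : ∀ {n} → ℕ → Graph n → Set
KRepresentable {n} k G = Σ (Word n) (λ w → Uniform k w × Represents w G)

CoBipartite : ∀ {n} → Graph n → Set
CoBipartite {n} G = Σ (Fin n → Bool) (λ side →
  ∀ (x y : Fin n) → x ≢ y → side x ≡ side y → Adj G x y)

module Submission where

open import Defs hiding (sym)
open import Data.Bool using (Bool; true; false; if_then_else_)
import Data.Bool as Bool
open import Data.Empty using (⊥; ⊥-elim)
open import Data.Fin using (Fin; zero; suc)
open import Data.Fin.Properties using (_≟_)
open import Data.Integer using (ℤ; +_; -_; _-_; +≤+; _≤?_; _⊓_; _⊔_) renaming (_+_ to _+ℤ_; _≤_ to _≤ℤ_)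
import Data.Integer.Properties as ℤ
import Data.Integer.Tactic.RingSolver as ℤ-Solver
import Data.List.Extrema ℤ.≤-totalOrder as Extrema
open import Data.List using (List; []; _∷_; _++_; filter; length; map; head; deduplicate)
open import Data.List.Membership.Propositional using (_∈_)
open import Data.List.Properties
  using (filter-accept; filter-reject; filter-++; filter-≐; filter-none; length-++; length-filter;
         map-++; map-∘; map-cong; ++-identityʳ)
open import Data.List.Relation.Unary.All using (All; []; _∷_)
import Data.List.Relation.Unary.All as All
import Data.List.Relation.Unary.All.Properties as All
open import Data.List.Relation.Unary.AllPairs using (AllPairs; []; _∷_)
import Data.List.Relation.Unary.AllPairs as AllPairs
import Data.List.Relation.Unary.AllPairs.Properties as AllPairs
open import Data.List.Relation.Unary.Any using (Any; here; there)
import Data.List.Relation.Unary.Any as Any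
import Data.List.Relation.Unary.Any.Properties as Any
open import Data.List.Relation.Unary.Unique.Propositional using (Unique)
open import Data.List.Relation.Unary.Unique.DecPropositional.Properties using (deduplicate-!)
open import Data.Maybe using (Maybe; just)
import Data.Maybe.Properties as Maybe
open import Data.Nat using (ℕ; zero; suc; _+_; _*_; _≤_; _<_; _<?_; z≤n; s≤s)
open import Data.Nat.Properties
  using (+-*-semiring; +-commutativeSemigroup; suc-injective; ≤-refl; ≤-reflexive; ≤-trans; ≤-antisym; ≤-pred; ≤-<-trans;
         <-irrefl; <⇒≤; <⇒≱; ≮⇒≥; n≮0; n≤0⇒n≡0; n<1+n; n≤1+n; m≤m+n; m≤n+m; m<m+n; m<n+m; m≤n⇒m≤1+n; m≤n⇒m<n∨m≡n;
         +-identityʳ; +-comm; +-assoc; +-suc; +-mono-≤; +-monoˡ-≤; +-cancelˡ-<; +-cancelʳ-≤;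
         *-comm; *-identityʳ; *-zeroʳ; *-suc; *-distribˡ-+; *-cancelˡ-<; module ≤-Reasoning)
open import Data.Nat.Tactic.RingSolver using (solve-∀)
open import Algebra.Properties.CommutativeSemigroup +-commutativeSemigroup using (x∙yz≈y∙xz)
open import Algebra.Properties.Semiring.Sum +-*-semiring
  using (sum; sum-cong-≗; sum-replicate-zero; ∑-distrib-+; *-distribˡ-sum; *-distribʳ-sum)
open import Data.Product using (_×_; _,_; proj₁; proj₂; ∃; ∃-syntax)
open import Data.Sum using (_⊎_; inj₁; inj₂)
open import Data.Sum.Function.Propositional using (_⊎-⇔_)
open import Data.Unit using (⊤)
open import Function using (_∘_; id)
open import Function.Bundles using (_⇔_; mk⇔; Equivalence)
import Function.Properties.Equivalence as ⇔
open import Level using (0ℓ)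
open import Relation.Binary.PropositionalEquality
open import Relation.Nullary using (¬_; Dec; yes; no; ¬?; does)
open import Relation.Nullary.Decidable using (_⊎-dec_; _×-dec_; toSum)
open import Relation.Unary using (Pred; Decidable)

open Extrema using (min; max)

NoAdjRepeat-tail : ∀ {A : Set} {a : A} {l} → NoAdjRepeat (a ∷ l) → NoAdjRepeat l
NoAdjRepeat-tail (one _) = nil
NoAdjRepeat-tail (cons _ _ _ _ p) = p

module _ {n : ℕ} where

  count-∷-≡ : ∀ x (w : Word n) → count x (x ∷ w) ≡ suc (count x w)
  count-∷-≡ x w = cong length (filter-accept (_≟ x) refl)

  count-∷-≢ : ∀ {a x} (w : Word n) → a ≢ x → count x (a ∷ w) ≡ count x w
  count-∷-≢ {x = x} w a≢x = cong length (filter-reject (_≟ x) a≢x)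

  count-++ : ∀ x (w w′ : Word n) → count x (w ++ w′) ≡ count x w + count x w′
  count-++ x w w′ = trans (cong length (filter-++ (_≟ x) w w′)) (length-++ (filter (_≟ x) w))

  count-prefix-≤ : ∀ x (w w′ : Word n) → count x w ≤ count x (w ++ w′)
  count-prefix-≤ x w w′ rewrite count-++ x w w′ = m≤m+n _ _

  ∈⇒count>0 : ∀ {x} {w : Word n} → x ∈ w → 0 < count x w
  ∈⇒count>0 {x} {_ ∷ w} (here refl) rewrite count-∷-≡ x w = s≤s z≤n
  ∈⇒count>0 {x} {a ∷ w} (there x∈w) with a ≟ x
  ... | yes refl = s≤s z≤n
  ... | no _ = ∈⇒count>0 x∈w

  count>0⇒∈ : ∀ {x} (w : Word n) → 0 < count x w → x ∈ w
  count>0⇒∈ {x} (a ∷ w) pos with a ≟ x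
  ... | yes refl = here refl
  ... | no _ = there (count>0⇒∈ w pos)

  module _ {P Q : Pred (Fin n) 0ℓ} (P? : Decidable P) (Q? : Decidable Q) where

    filter-filter-⊆ : (∀ {z} → Q z → P z) → (w : Word n) → filter Q? (filter P? w) ≡ filter Q? w
    filter-filter-⊆ Q⊆P [] = refl
    filter-filter-⊆ Q⊆P (a ∷ w) with P? a | Q? a
    ... | yes pa | yes qa rewrite filter-accept Q? {xs = filter P? w} qa = cong (a ∷_) (filter-filter-⊆ Q⊆P w)
    ... | yes pa | no ¬qa rewrite filter-reject Q? {xs = filter P? w} ¬qa = filter-filter-⊆ Q⊆P w
    ... | no ¬pa | yes qa = ⊥-elim (¬pa (Q⊆P qa))
    ... | no ¬pa | no ¬qa = filter-filter-⊆ Q⊆P w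

    filter-comm : (w : Word n) → filter Q? (filter P? w) ≡ filter P? (filter Q? w)
    filter-comm [] = refl
    filter-comm (a ∷ w) with P? a | Q? a
    ... | yes pa | yes qa rewrite filter-accept Q? {xs = filter P? w} qa | filter-accept P? {xs = filter Q? w} pa = cong (a ∷_) (filter-comm w)
    ... | yes pa | no ¬qa rewrite filter-reject Q? {xs = filter P? w} ¬qa = filter-comm w
    ... | no ¬pa | yes qa rewrite filter-reject P? {xs = filter Q? w} ¬pa = filter-comm w
    ... | no ¬pa | no ¬qa = filter-comm w

  module _ {P : Pred (Fin n) 0ℓ} (P? : Decidable P) where

    count-filter-accept : ∀ {x} (w : Word n) → P x → count x (filter P? w) ≡ count x w
    count-filter-accept {x} w px = cong length (filter-filter-⊆ P? (_≟ x) (λ { refl → px }) w)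

    count-filter-reject : ∀ {x} (w : Word n) → ¬ P x → count x (filter P? w) ≡ 0
    count-filter-reject {x} w ¬px =
      cong length (filter-none (_≟ x) (All.map (λ { pz refl → ¬px pz }) (All.all-filter P? w)))

  restrict-∷-∈ : ∀ x y {a} (w : Word n) → a ≡ x ⊎ a ≡ y → restrict x y (a ∷ w) ≡ a ∷ restrict x y w
  restrict-∷-∈ x y w a∈xy = filter-accept (λ z → (z ≟ x) ⊎-dec (z ≟ y)) a∈xy

  restrict-∷-∉ : ∀ x y {a} (w : Word n) → a ≢ x → a ≢ y → restrict x y (a ∷ w) ≡ restrict x y w
  restrict-∷-∉ x y w a≢x a≢y = filter-reject (λ z → (z ≟ x) ⊎-dec (z ≟ y)) λ { (inj₁ e) → a≢x e ; (inj₂ e) → a≢y e }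

  restrict-++ : ∀ x y (w w′ : Word n) → restrict x y (w ++ w′) ≡ restrict x y w ++ restrict x y w′
  restrict-++ x y = filter-++ (λ z → (z ≟ x) ⊎-dec (z ≟ y))

  restrict-comm : ∀ x y (w : Word n) → restrict x y w ≡ restrict y x w
  restrict-comm x y = filter-≐ (λ z → (z ≟ x) ⊎-dec (z ≟ y)) (λ z → (z ≟ y) ⊎-dec (z ≟ x)) (swap , swap)
    where
    swap : ∀ {A B : Set} → A ⊎ B → B ⊎ A
    swap (inj₁ a) = inj₂ a
    swap (inj₂ b) = inj₁ b

  restrict-filter : {P : Pred (Fin n) 0ℓ} (P? : Decidable P) {x y : Fin n} (w : Word n) → P x → P y →
                    restrict x y (filter P? w) ≡ restrict x y w
  restrict-filter P? {x} {y} w px py = filter-filter-⊆ P? (λ z → (z ≟ x) ⊎-dec (z ≟ y)) (λ { (inj₁ refl) → px ; (inj₂ refl) → py }) w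

  Alternate-sym : ∀ x y (w : Word n) → Alternate x y w → Alternate y x w
  Alternate-sym x y w = subst NoAdjRepeat (restrict-comm x y w)

  first : Fin n → Fin n → Word n → Maybe (Fin n)
  first x y w = head (restrict x y w)

  Over : Fin n → Fin n → Word n → Set
  Over x y = All (λ z → z ≡ x ⊎ z ≡ y)

  restrict-over : ∀ x y (w : Word n) → Over x y (restrict x y w)
  restrict-over x y = All.all-filter (λ z → (z ≟ x) ⊎-dec (z ≟ y))

  count-restrictˡ : ∀ x y (w : Word n) → count x (restrict x y w) ≡ count x w
  count-restrictˡ x y [] = refl
  count-restrictˡ x y (a ∷ w) with toSum (a ≟ x) | toSum (a ≟ y)
  ... | inj₁ refl | _ = begin
    count x (restrict x y (x ∷ w))  ≡⟨ cong (count x) (restrict-∷-∈ x y w (inj₁ refl)) ⟩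
    count x (x ∷ restrict x y w)    ≡⟨ count-∷-≡ x _ ⟩
    suc (count x (restrict x y w))  ≡⟨ cong suc (count-restrictˡ x y w) ⟩
    suc (count x w)                 ≡⟨ count-∷-≡ x w ⟨
    count x (x ∷ w)                 ∎
    where open ≡-Reasoning
  ... | inj₂ a≢x | inj₁ refl = begin
    count x (restrict x y (y ∷ w))  ≡⟨ cong (count x) (restrict-∷-∈ x y w (inj₂ refl)) ⟩
    count x (y ∷ restrict x y w)    ≡⟨ count-∷-≢ _ a≢x ⟩
    count x (restrict x y w)        ≡⟨ count-restrictˡ x y w ⟩
    count x w                       ≡⟨ count-∷-≢ w a≢x ⟨
    count x (y ∷ w)                 ∎
    where open ≡-Reasoning
  ... | inj₂ a≢x | inj₂ a≢y = begin
    count x (restrict x y (a ∷ w))  ≡⟨ cong (count x) (restrict-∷-∉ x y w a≢x a≢y) ⟩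
    count x (restrict x y w)        ≡⟨ count-restrictˡ x y w ⟩
    count x w                       ≡⟨ count-∷-≢ w a≢x ⟨
    count x (a ∷ w)                 ∎
    where open ≡-Reasoning

  count-restrictʳ : ∀ x y (w : Word n) → count y (restrict x y w) ≡ count y w
  count-restrictʳ x y w = trans (cong (count y) (restrict-comm x y w)) (count-restrictˡ y x w)

  first-cases : ∀ x y (w : Word n) →
                first x y w ≡ just x ⊎ first x y w ≡ just y ⊎ (count x w ≡ 0 × count y w ≡ 0)
  first-cases x y w with restrict x y w in eq | restrict-over x y w
  ... | [] | _ = inj₂ (inj₂ (trans (sym (count-restrictˡ x y w)) (cong (count x) eq) ,
                             trans (sym (count-restrictʳ x y w)) (cong (count y) eq)))
  ... | c ∷ _ | inj₁ refl ∷ _ = inj₁ refl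
  ... | c ∷ _ | inj₂ refl ∷ _ = inj₂ (inj₁ refl)

  initialPermutation : Word n → Word n
  initialPermutation = deduplicate _≟_

  count-initialPermutation : ∀ {x} (w : Word n) → x ∈ w → count x (initialPermutation w) ≡ 1
  count-initialPermutation {x} (a ∷ w) x∈a∷w with toSum (a ≟ x) | x∈a∷w
  ... | inj₁ refl | _ = trans (count-∷-≡ a _)
    (cong suc (count-filter-reject (λ z → ¬? (a ≟ z)) (initialPermutation w) (λ a≢a → a≢a refl)))
  ... | inj₂ a≢x | here x≡a = ⊥-elim (a≢x (sym x≡a))
  ... | inj₂ a≢x | there x∈w = trans (count-∷-≢ _ a≢x)
    (trans (count-filter-accept (λ z → ¬? (a ≟ z)) (initialPermutation w) a≢x) (count-initialPermutation w x∈w))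

  first-initialPermutation : ∀ x y (w : Word n) → first x y (initialPermutation w) ≡ first x y w
  first-initialPermutation x y [] = refl
  first-initialPermutation x y (a ∷ w) with toSum (a ≟ x) | toSum (a ≟ y)
  ... | inj₁ a≡x | _ = trans (cong head (restrict-∷-∈ x y _ (inj₁ a≡x))) (sym (cong head (restrict-∷-∈ x y w (inj₁ a≡x))))
  ... | inj₂ _ | inj₁ a≡y = trans (cong head (restrict-∷-∈ x y _ (inj₂ a≡y))) (sym (cong head (restrict-∷-∈ x y w (inj₂ a≡y))))
  ... | inj₂ a≢x | inj₂ a≢y = begin
    head (restrict x y (a ∷ filter (λ z → ¬? (a ≟ z)) (initialPermutation w)))
      ≡⟨ cong head (restrict-∷-∉ x y _ a≢x a≢y) ⟩
    head (restrict x y (filter (λ z → ¬? (a ≟ z)) (initialPermutation w)))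
      ≡⟨ cong head (restrict-filter (λ z → ¬? (a ≟ z)) (initialPermutation w) a≢x a≢y) ⟩
    first x y (initialPermutation w)
      ≡⟨ first-initialPermutation x y w ⟩
    first x y w
      ≡⟨ cong head (restrict-∷-∉ x y w a≢x a≢y) ⟨
    first x y (a ∷ w) ∎
    where open ≡-Reasoning

  Unique⇒first-ordered : ∀ {l : Word n} → Unique l → AllPairs (λ z z′ → first z z′ l ≡ just z) l
  Unique⇒first-ordered {[]} [] = []
  Unique⇒first-ordered {a ∷ l} (a∉l ∷ unique) =
    All.tabulate (λ {z} _ → cong head (restrict-∷-∈ a z l (inj₁ refl))) ∷ skip-head a∉l (Unique⇒first-ordered unique)
    where
    skip-head : ∀ {m} → All (a ≢_) m → AllPairs (λ z z′ → first z z′ l ≡ just z) m →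
                AllPairs (λ z z′ → first z z′ (a ∷ l) ≡ just z) m
    skip-head [] [] = []
    skip-head {z ∷ _} (a≢z ∷ a∉m) (ordered ∷ orderedm) = All.zipWith skip (a∉m , ordered) ∷ skip-head a∉m orderedm
      where
      skip : ∀ {z′} → a ≢ z′ × first z z′ l ≡ just z → first z z′ (a ∷ l) ≡ just z
      skip (a≢z′ , e) = trans (cong head (restrict-∷-∉ z _ l a≢z a≢z′)) e

  initialPermutation-ordered : (w : Word n) →
    AllPairs (λ z z′ → z ≢ z′ × first z z′ w ≡ just z) (initialPermutation w)
  initialPermutation-ordered w = AllPairs.zipWith
    (λ {z} {z′} (z≢z′ , e) → z≢z′ , trans (sym (first-initialPermutation z z′ w)) e)
    (deduplicate-! _≟_ w , Unique⇒first-ordered (deduplicate-! _≟_ w))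

  over-count-0-0 : ∀ {x y} (r : Word n) → Over x y r → count x r ≡ 0 → count y r ≡ 0 → r ≡ []
  over-count-0-0 [] _ _ _ = refl
  over-count-0-0 (c ∷ r) (inj₁ refl ∷ _) cx≡0 _ with trans (sym (count-∷-≡ c r)) cx≡0
  ... | ()
  over-count-0-0 (c ∷ r) (inj₂ refl ∷ _) _ cy≡0 with trans (sym (count-∷-≡ c r)) cy≡0
  ... | ()

  over-count-0-1 : ∀ {x y} → x ≢ y → (r : Word n) → Over x y r → count x r ≡ 0 → count y r ≡ 1 → r ≡ y ∷ []
  over-count-0-1 x≢y (c ∷ r) (inj₁ refl ∷ _) cx≡0 _ with trans (sym (count-∷-≡ c r)) cx≡0
  ... | ()
  over-count-0-1 x≢y (c ∷ r) (inj₂ refl ∷ over) cx≡0 cy≡1 = cong (c ∷_)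
    (over-count-0-0 r over (trans (sym (count-∷-≢ r (≢-sym x≢y))) cx≡0) (suc-injective (trans (sym (count-∷-≡ c r)) cy≡1)))

  over-count-1-1 : ∀ {x y} → x ≢ y → (r : Word n) → Over x y r → count x r ≡ 1 → count y r ≡ 1 →
                   r ≡ x ∷ y ∷ [] ⊎ r ≡ y ∷ x ∷ []
  over-count-1-1 x≢y (c ∷ r) (inj₁ refl ∷ over) cx≡1 cy≡1 = inj₁ (cong (c ∷_)
    (over-count-0-1 x≢y r over (suc-injective (trans (sym (count-∷-≡ c r)) cx≡1)) (trans (sym (count-∷-≢ r x≢y)) cy≡1)))
  over-count-1-1 x≢y (c ∷ r) (inj₂ refl ∷ over) cx≡1 cy≡1 = inj₂ (cong (c ∷_)
    (over-count-0-1 (≢-sym x≢y) r (All.map swap over)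
      (suc-injective (trans (sym (count-∷-≡ c r)) cy≡1)) (trans (sym (count-∷-≢ r (≢-sym x≢y))) cx≡1)))
    where
    swap : ∀ {A B : Set} → A ⊎ B → B ⊎ A
    swap (inj₁ a) = inj₂ a
    swap (inj₂ b) = inj₁ b

  restrict-initialPermutation : ∀ {x y} (w : Word n) → x ≢ y → x ∈ w → y ∈ w →
    restrict x y (initialPermutation w) ≡ x ∷ y ∷ [] ⊎ restrict x y (initialPermutation w) ≡ y ∷ x ∷ []
  restrict-initialPermutation {x} {y} w x≢y x∈w y∈w = over-count-1-1 x≢y _ (restrict-over x y π)
    (trans (count-restrictˡ x y π) (count-initialPermutation w x∈w))
    (trans (count-restrictʳ x y π) (count-initialPermutation w y∈w))
    where
    π = initialPermutation w

  prefixesBefore : Fin n → Word n → List (Word n)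
  prefixesBefore x [] = []
  prefixesBefore x (a ∷ w) with a ≟ x
  ... | yes _ = [] ∷ map (a ∷_) (prefixesBefore x w)
  ... | no _ = map (a ∷_) (prefixesBefore x w)

  prefixesBefore-∷-≡ : ∀ x (w : Word n) → prefixesBefore x (x ∷ w) ≡ [] ∷ map (x ∷_) (prefixesBefore x w)
  prefixesBefore-∷-≡ x w with x ≟ x
  ... | yes _ = refl
  ... | no x≢x = ⊥-elim (x≢x refl)

  prefixesBefore-∷-≢ : ∀ {a x} (w : Word n) → a ≢ x → prefixesBefore x (a ∷ w) ≡ map (a ∷_) (prefixesBefore x w)
  prefixesBefore-∷-≢ {a} {x} w a≢x with a ≟ x
  ... | yes a≡x = ⊥-elim (a≢x a≡x)
  ... | no _ = refl

  prefixesBefore-split : ∀ x (w : Word n) → All (λ p → ∃ λ s → w ≡ p ++ x ∷ s) (prefixesBefore x w)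
  prefixesBefore-split x [] = []
  prefixesBefore-split x (a ∷ w) with a ≟ x
  ... | yes refl = (w , refl) ∷ All.map⁺ (All.map (λ (s , e) → s , cong (a ∷_) e) (prefixesBefore-split x w))
  ... | no _ = All.map⁺ (All.map (λ (s , e) → s , cong (a ∷_) e) (prefixesBefore-split x w))

  prefixBefore-within : ∀ x (q s : Word n) t → t < count x q →
    Any (λ p → count x p ≡ t × ∃ λ r → q ≡ p ++ r) (prefixesBefore x (q ++ s))
  prefixBefore-within x (a ∷ q) s t t<cx with a ≟ x | t
  ... | yes refl | zero = here (refl , a ∷ q , refl)
  ... | yes refl | suc t′ = there (Any.map⁺ (Any.map
        (λ {p} (e , r , eq) → trans (count-∷-≡ a p) (cong suc e) , r , cong (a ∷_) eq)
        (prefixBefore-within x q s t′ (≤-pred t<cx))))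
  ... | no a≢x | t = Any.map⁺ (Any.map
        (λ {p} (e , r , eq) → trans (count-∷-≢ p a≢x) e , r , cong (a ∷_) eq)
        (prefixBefore-within x q s t t<cx))

  prefixBefore-beyond : ∀ x (q s : Word n) t → count x q ≤ t → t < count x (q ++ s) →
    Any (λ p → count x p ≡ t × ∃ λ r → p ≡ q ++ r) (prefixesBefore x (q ++ s))
  prefixBefore-beyond x [] s t _ t<cx = Any.map (λ {p} (e , _) → e , p , refl)
    (subst (Any _) (cong (prefixesBefore x) (++-identityʳ s)) (prefixBefore-within x s [] t t<cx))
  prefixBefore-beyond x (a ∷ q) s t cx≤t t<cx with a ≟ x | t
  ... | yes refl | zero = ⊥-elim (n≮0 cx≤t)
  ... | yes refl | suc t′ = there (Any.map⁺ (Any.map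
        (λ {p} (e , r , eq) → trans (count-∷-≡ a p) (cong suc e) , r , cong (a ∷_) eq)
        (prefixBefore-beyond x q s t′ (≤-pred cx≤t) (≤-pred t<cx))))
  ... | no a≢x | t = Any.map⁺ (Any.map
        (λ {p} (e , r , eq) → trans (count-∷-≢ p a≢x) e , r , cong (a ∷_) eq)
        (prefixBefore-beyond x q s t cx≤t t<cx))

  prefixBefore-first : ∀ x (w : Word n) → 0 < count x w → Any (λ p → count x p ≡ 0) (prefixesBefore x w)
  prefixBefore-first x w pos = Any.map proj₁
    (subst (Any _) (cong (prefixesBefore x) (++-identityʳ w)) (prefixBefore-within x w [] 0 pos))

  restrict-map-∷-∈ : ∀ x y {a} (ps : List (Word n)) → a ≡ x ⊎ a ≡ y →
                     map (restrict x y) (map (a ∷_) ps) ≡ map (a ∷_) (map (restrict x y) ps)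
  restrict-map-∷-∈ x y ps a∈xy = trans (sym (map-∘ ps)) (trans (map-cong (λ p → restrict-∷-∈ x y p a∈xy) ps) (map-∘ ps))

  restrict-map-∷-∉ : ∀ x y {a} (ps : List (Word n)) → a ≢ x → a ≢ y →
                     map (restrict x y) (map (a ∷_) ps) ≡ map (restrict x y) ps
  restrict-map-∷-∉ x y ps a≢x a≢y = trans (sym (map-∘ ps)) (map-cong (λ p → restrict-∷-∉ x y p a≢x a≢y) ps)

  prefixesBefore-restrict : ∀ x y (w : Word n) → prefixesBefore x (restrict x y w) ≡ map (restrict x y) (prefixesBefore x w)
  prefixesBefore-restrict x y [] = refl
  prefixesBefore-restrict x y (a ∷ w) with toSum (a ≟ x) | toSum (a ≟ y)
  ... | inj₁ refl | _ = begin
    prefixesBefore x (restrict x y (x ∷ w))                    ≡⟨ cong (prefixesBefore x) (restrict-∷-∈ x y w (inj₁ refl)) ⟩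
    prefixesBefore x (x ∷ restrict x y w)                      ≡⟨ prefixesBefore-∷-≡ x _ ⟩
    [] ∷ map (x ∷_) (prefixesBefore x (restrict x y w))        ≡⟨ cong (λ ps → [] ∷ map (x ∷_) ps) (prefixesBefore-restrict x y w) ⟩
    [] ∷ map (x ∷_) (map (restrict x y) (prefixesBefore x w))  ≡⟨ cong ([] ∷_) (restrict-map-∷-∈ x y _ (inj₁ refl)) ⟨
    map (restrict x y) ([] ∷ map (x ∷_) (prefixesBefore x w))  ≡⟨ cong (map (restrict x y)) (prefixesBefore-∷-≡ x w) ⟨
    map (restrict x y) (prefixesBefore x (x ∷ w))              ∎
    where open ≡-Reasoning
  ... | inj₂ a≢x | inj₁ refl = begin
    prefixesBefore x (restrict x y (y ∷ w))                    ≡⟨ cong (prefixesBefore x) (restrict-∷-∈ x y w (inj₂ refl)) ⟩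
    prefixesBefore x (y ∷ restrict x y w)                      ≡⟨ prefixesBefore-∷-≢ _ a≢x ⟩
    map (y ∷_) (prefixesBefore x (restrict x y w))             ≡⟨ cong (map (y ∷_)) (prefixesBefore-restrict x y w) ⟩
    map (y ∷_) (map (restrict x y) (prefixesBefore x w))       ≡⟨ restrict-map-∷-∈ x y _ (inj₂ refl) ⟨
    map (restrict x y) (map (y ∷_) (prefixesBefore x w))       ≡⟨ cong (map (restrict x y)) (prefixesBefore-∷-≢ w a≢x) ⟨
    map (restrict x y) (prefixesBefore x (y ∷ w))              ∎
    where open ≡-Reasoning
  ... | inj₂ a≢x | inj₂ a≢y = begin
    prefixesBefore x (restrict x y (a ∷ w))                    ≡⟨ cong (prefixesBefore x) (restrict-∷-∉ x y w a≢x a≢y) ⟩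
    prefixesBefore x (restrict x y w)                          ≡⟨ prefixesBefore-restrict x y w ⟩
    map (restrict x y) (prefixesBefore x w)                    ≡⟨ restrict-map-∷-∉ x y _ a≢x a≢y ⟨
    map (restrict x y) (map (a ∷_) (prefixesBefore x w))       ≡⟨ cong (map (restrict x y)) (prefixesBefore-∷-≢ w a≢x) ⟨
    map (restrict x y) (prefixesBefore x (a ∷ w))              ∎
    where open ≡-Reasoning

  Lead : Fin n → Fin n → ℕ → Word n → Set
  Lead x y d w = All (λ p → count y p ≡ d + count x p) (prefixesBefore x w)

  Lead-restrict⁺ : ∀ x y d (w : Word n) → Lead x y d w → Lead x y d (restrict x y w)
  Lead-restrict⁺ x y d w lead rewrite prefixesBefore-restrict x y w = All.map⁺ (All.map
    (λ {p} e → trans (count-restrictʳ x y p) (trans e (cong (λ m → d + m) (sym (count-restrictˡ x y p))))) lead)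

  Lead-restrict⁻ : ∀ x y d (w : Word n) → Lead x y d (restrict x y w) → Lead x y d w
  Lead-restrict⁻ x y d w lead rewrite prefixesBefore-restrict x y w = All.map
    (λ {p} e → trans (sym (count-restrictʳ x y p)) (trans e (cong (λ m → d + m) (count-restrictˡ x y p)))) (All.map⁻ lead)

  module _ {x y : Fin n} (x≢y : x ≢ y) where

    Lead-∷x⁺ : ∀ w → Lead x y 1 w → Lead x y 0 (x ∷ w)
    Lead-∷x⁺ w lead rewrite prefixesBefore-∷-≡ x w = refl ∷ All.map⁺ (All.map
      (λ {p} e → trans (count-∷-≢ p x≢y) (trans e (sym (count-∷-≡ x p)))) lead)

    Lead-∷x⁻ : ∀ w → Lead x y 0 (x ∷ w) → Lead x y 1 w
    Lead-∷x⁻ w lead rewrite prefixesBefore-∷-≡ x w = All.map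
      (λ {p} e → trans (sym (count-∷-≢ p x≢y)) (trans e (count-∷-≡ x p))) (All.map⁻ (All.tail lead))

    Lead-∷x-suc : ∀ {d} w → ¬ Lead x y (suc d) (x ∷ w)
    Lead-∷x-suc w lead rewrite prefixesBefore-∷-≡ x w with All.head lead
    ... | ()

    Lead-∷y⁺ : ∀ {d} w → Lead x y d w → Lead x y (suc d) (y ∷ w)
    Lead-∷y⁺ {d} w lead rewrite prefixesBefore-∷-≢ w (≢-sym x≢y) = All.map⁺ (All.map
      (λ {p} e → trans (count-∷-≡ y p) (trans (cong suc e) (cong (λ m → suc d + m) (sym (count-∷-≢ p (≢-sym x≢y)))))) lead)

    Lead-∷y⁻ : ∀ {d} w → Lead x y (suc d) (y ∷ w) → Lead x y d w
    Lead-∷y⁻ {d} w lead rewrite prefixesBefore-∷-≢ w (≢-sym x≢y) = All.map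
      (λ {p} e → suc-injective (trans (sym (count-∷-≡ y p)) (trans e (cong (λ m → suc d + m) (count-∷-≢ p (≢-sym x≢y))))))
      (All.map⁻ lead)

    Lead₀-∷y : ∀ w → Lead x y 0 (y ∷ w) → count x w ≡ 0
    Lead₀-∷y w lead with count x w in cx
    ... | zero = refl
    ... | suc _ rewrite prefixesBefore-∷-≢ w (≢-sym x≢y) =
      ⊥-elim (All.lookupWith clash (All.map⁻ lead) (prefixBefore-first x w (subst (0 <_) (sym cx) (s≤s z≤n))))
      where
      clash : ∀ {p} → count y (y ∷ p) ≡ count x (y ∷ p) → count x p ≡ 0 → ⊥
      clash {p} e cx≡0 with trans (sym (count-∷-≡ y p)) (trans e (trans (count-∷-≢ p (≢-sym x≢y)) cx≡0))
      ... | ()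

    alternating⇒Lead₀ : ∀ r → Over x y r → NoAdjRepeat (x ∷ r) → Lead x y 0 (x ∷ r)
    alternating⇒Lead₁ : ∀ r → Over x y r → NoAdjRepeat (y ∷ r) → Lead x y 1 (y ∷ r)

    alternating⇒Lead₀ [] _ _ = Lead-∷x⁺ [] []
    alternating⇒Lead₀ (_ ∷ _) (inj₁ refl ∷ _) (cons _ _ _ x≢x _) = ⊥-elim (x≢x refl)
    alternating⇒Lead₀ (_ ∷ r) (inj₂ refl ∷ over) (cons _ _ _ _ alt) = Lead-∷x⁺ (y ∷ r) (alternating⇒Lead₁ r over alt)

    alternating⇒Lead₁ [] _ _ = Lead-∷y⁺ [] []
    alternating⇒Lead₁ (_ ∷ _) (inj₂ refl ∷ _) (cons _ _ _ y≢y _) = ⊥-elim (y≢y refl)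
    alternating⇒Lead₁ (_ ∷ r) (inj₁ refl ∷ over) (cons _ _ _ _ alt) = Lead-∷y⁺ (x ∷ r) (alternating⇒Lead₀ r over alt)

    Lead₀⇒alternating : ∀ r → Over x y r → Lead x y 0 r → count y r ≤ count x r → NoAdjRepeat (y ∷ r)
    Lead₁⇒alternating : ∀ r → Over x y r → Lead x y 1 r → count y r ≤ suc (count x r) → NoAdjRepeat (x ∷ r)

    Lead₀⇒alternating [] _ _ _ = one y
    Lead₀⇒alternating (_ ∷ r) (inj₁ refl ∷ over) lead cy≤cx = cons y x r (≢-sym x≢y)
      (Lead₁⇒alternating r over (Lead-∷x⁻ r lead) (subst₂ _≤_ (count-∷-≢ r x≢y) (count-∷-≡ x r) cy≤cx))
    Lead₀⇒alternating (_ ∷ r) (inj₂ refl ∷ _) lead cy≤cx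
      rewrite count-∷-≡ y r | count-∷-≢ r (≢-sym x≢y) | Lead₀-∷y r lead with cy≤cx
    ... | ()

    Lead₁⇒alternating [] _ _ _ = one x
    Lead₁⇒alternating (_ ∷ r) (inj₁ refl ∷ _) lead _ = ⊥-elim (Lead-∷x-suc r lead)
    Lead₁⇒alternating (_ ∷ r) (inj₂ refl ∷ over) lead cy≤1+cx = cons x y r x≢y
      (Lead₀⇒alternating r over (Lead-∷y⁻ r lead) (≤-pred (subst₂ _≤_ (count-∷-≡ y r) (cong suc (count-∷-≢ r (≢-sym x≢y))) cy≤1+cx)))

  alternate⇒Lead₀ : ∀ {x y} (w : Word n) → x ≢ y → Alternate x y w → first x y w ≡ just x → Lead x y 0 w
  alternate⇒Lead₀ {x} {y} w x≢y alt x-first = Lead-restrict⁻ x y 0 w (go (restrict x y w) (restrict-over x y w) alt x-first)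
    where
    go : ∀ r → Over x y r → NoAdjRepeat r → head r ≡ just x → Lead x y 0 r
    go (_ ∷ r) (inj₁ refl ∷ over) alt refl = alternating⇒Lead₀ x≢y r over alt
    go (_ ∷ _) (inj₂ refl ∷ _) _ y≡x = ⊥-elim (x≢y (sym (Maybe.just-injective y≡x)))

  alternate⇒Lead₁ : ∀ {x y} (w : Word n) → x ≢ y → Alternate x y w → first x y w ≡ just y → Lead x y 1 w
  alternate⇒Lead₁ {x} {y} w x≢y alt y-first = Lead-restrict⁻ x y 1 w (go (restrict x y w) (restrict-over x y w) alt y-first)
    where
    go : ∀ r → Over x y r → NoAdjRepeat r → head r ≡ just y → Lead x y 1 r
    go (_ ∷ _) (inj₁ refl ∷ _) _ x≡y = ⊥-elim (x≢y (Maybe.just-injective x≡y))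
    go (_ ∷ r) (inj₂ refl ∷ over) alt refl = alternating⇒Lead₁ x≢y r over alt

  Lead⇒alternate : ∀ {x y} (w : Word n) → x ≢ y → count x w ≡ count y w → Lead x y 0 w ⊎ Lead x y 1 w → Alternate x y w
  Lead⇒alternate {x} {y} w x≢y cx≡cy = from-Lead
    where
    r = restrict x y w
    cy≤cx : count y r ≤ count x r
    cy≤cx = ≤-reflexive (begin
      count y r  ≡⟨ count-restrictʳ x y w ⟩
      count y w  ≡⟨ cx≡cy ⟨
      count x w  ≡⟨ count-restrictˡ x y w ⟨
      count x r  ∎)
      where open ≡-Reasoning
    from-Lead : Lead x y 0 w ⊎ Lead x y 1 w → NoAdjRepeat r
    from-Lead (inj₁ lead) = NoAdjRepeat-tail
      (Lead₀⇒alternating x≢y r (restrict-over x y w) (Lead-restrict⁺ x y 0 w lead) cy≤cx)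
    from-Lead (inj₂ lead) = NoAdjRepeat-tail
      (Lead₁⇒alternating x≢y r (restrict-over x y w) (Lead-restrict⁺ x y 1 w lead) (m≤n⇒m≤1+n cy≤cx))

  Balanced : Fin n → Fin n → Word n → Set
  Balanced a b p = count b p ≤ count a p × count a p ≤ suc (count b p)

  alternating-prefix-balanced : ∀ {a b} → a ≢ b → ∀ q s → Over a b (q ++ s) → NoAdjRepeat (a ∷ q ++ s) → Balanced a b (a ∷ q)
  alternating-prefix-balanced {a} {b} a≢b [] _ _ _ rewrite count-∷-≢ [] a≢b | count-∷-≡ a [] = z≤n , s≤s z≤n
  alternating-prefix-balanced a≢b (_ ∷ _) _ (inj₁ refl ∷ _) (cons _ _ _ a≢a _) = ⊥-elim (a≢a refl)
  alternating-prefix-balanced {a} {b} a≢b (_ ∷ []) _ (inj₂ refl ∷ _) _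
    rewrite count-∷-≢ (b ∷ []) a≢b | count-∷-≡ b [] | count-∷-≡ a (b ∷ []) | count-∷-≢ [] (≢-sym a≢b) = s≤s z≤n , s≤s z≤n
  alternating-prefix-balanced a≢b (_ ∷ _ ∷ _) _ (inj₂ refl ∷ inj₂ refl ∷ _) (cons _ _ _ _ (cons _ _ _ b≢b _)) = ⊥-elim (b≢b refl)
  alternating-prefix-balanced {a} {b} a≢b (_ ∷ _ ∷ q) s (inj₂ refl ∷ inj₁ refl ∷ over) (cons _ _ _ _ (cons _ _ _ _ alt))
    with alternating-prefix-balanced a≢b q s over alt
  ... | cb≤ca , ca≤1+cb
    rewrite count-∷-≢ (b ∷ a ∷ q) a≢b | count-∷-≡ b (a ∷ q) | count-∷-≡ a (b ∷ a ∷ q) | count-∷-≢ (a ∷ q) (≢-sym a≢b) =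
    s≤s cb≤ca , s≤s ca≤1+cb

  alternate-prefix-balanced : ∀ {a b} → a ≢ b → ∀ p s → Alternate a b (p ++ s) → first a b (p ++ s) ≡ just a → Balanced a b p
  alternate-prefix-balanced {a} {b} a≢b p s alt a-first =
    subst₂ (λ cb ca → cb ≤ ca × ca ≤ suc cb) (count-restrictʳ a b p) (count-restrictˡ a b p)
      (go (restrict a b p) (restrict a b s)
        (subst (Over a b) split (restrict-over a b (p ++ s))) (subst NoAdjRepeat split alt)
        (trans (cong head (sym split)) a-first))
    where
    split = restrict-++ a b p s
    go : ∀ q r → Over a b (q ++ r) → NoAdjRepeat (q ++ r) → head (q ++ r) ≡ just a → Balanced a b q
    go [] _ _ _ _ = z≤n , z≤n
    go (_ ∷ q) r (inj₁ refl ∷ over) alt refl = alternating-prefix-balanced a≢b q r over alt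
    go (_ ∷ _) _ (inj₂ refl ∷ _) _ b≡a = ⊥-elim (a≢b (sym (Maybe.just-injective b≡a)))

  alternate-balanced : ∀ {a b} (w : Word n) → a ≢ b → Alternate a b w → first a b w ≡ just a → Balanced a b w
  alternate-balanced {a} {b} w a≢b alt a-first = alternate-prefix-balanced a≢b w []
    (subst (Alternate a b) (sym (++-identityʳ w)) alt) (trans (cong (first a b) (++-identityʳ w)) a-first)

head-just : ∀ {A : Set} {a : A} (l : List A) → head l ≡ just a → ∃ λ l′ → l ≡ a ∷ l′
head-just (_ ∷ l) refl = l , refl

module _ {n : ℕ} where

  prefixesBefore-absent : ∀ x (w : Word n) → count x w ≡ 0 → prefixesBefore x w ≡ []
  prefixesBefore-absent x [] _ = refl
  prefixesBefore-absent x (a ∷ w) cx≡0 with a ≟ x | cx≡0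
  ... | yes _ | ()
  ... | no _ | cx≡0′ = cong (map (a ∷_)) (prefixesBefore-absent x w cx≡0′)

  count-before : ∀ x (p s : Word n) → count x p < count x (p ++ x ∷ s)
  count-before x p s rewrite count-++ x p (x ∷ s) | count-∷-≡ x s = m<m+n (count x p) (s≤s z≤n)

AllPairs-All : ∀ {A : Set} {P : A → Set} {R : A → A → Set} {xs : List A} →
               All P xs → AllPairs R xs → AllPairs (λ x y → P x × P y × R x y) xs
AllPairs-All [] [] = []
AllPairs-All (px ∷ pxs) (rx ∷ rxs) = All.zipWith (λ (py , r) → px , py , r) (pxs , rx) ∷ AllPairs-All pxs rxs

module _ {n : ℕ} (K : ℕ) where

  short : Word n → Word n
  short w = filter (λ v → count v w <? K) (initialPermutation w)

  pad : Word n → Word n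
  pad w = short w ++ w

  Bounded : Word n → Set
  Bounded w = ∀ v → 0 < count v w × count v w ≤ K

  count-pad-< : ∀ {v} (w : Word n) → v ∈ w → count v w < K → count v (pad w) ≡ suc (count v w)
  count-pad-< {v} w v∈w cv<K = trans (count-++ v (short w) w) (cong (_+ count v w)
    (trans (count-filter-accept (λ v → count v w <? K) (initialPermutation w) cv<K) (count-initialPermutation w v∈w)))

  count-pad-≥ : ∀ {v} (w : Word n) → ¬ count v w < K → count v (pad w) ≡ count v w
  count-pad-≥ {v} w cv≮K = trans (count-++ v (short w) w) (cong (_+ count v w)
    (count-filter-reject (λ v → count v w <? K) (initialPermutation w) cv≮K))

  alternate-pad-ordered : ∀ {a b} (w : Word n) → Bounded w → a ≢ b → restrict a b (initialPermutation w) ≡ a ∷ b ∷ [] →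
                          Alternate a b (pad w) ⇔ Alternate a b w
  alternate-pad-ordered {a} {b} w bounded a≢b π≡ab with head-just (restrict a b w) (trans (sym (first-initialPermutation a b w)) (cong head π≡ab))
  ... | r , w≡ar = by-cases (count a w <? K) (count b w <? K)
    where
    P? = λ v → count v w <? K
    a-first : first a b w ≡ just a
    a-first = cong head w≡ar
    restrict-pad : restrict a b (pad w) ≡ filter P? (a ∷ b ∷ []) ++ a ∷ r
    restrict-pad = begin
      restrict a b (short w ++ w)               ≡⟨ restrict-++ a b (short w) w ⟩
      restrict a b (short w) ++ restrict a b w  ≡⟨ cong₂ _++_ (trans (filter-comm P? _ (initialPermutation w)) (cong (filter P?) π≡ab)) w≡ar ⟩
      filter P? (a ∷ b ∷ []) ++ a ∷ r           ∎
      where open ≡-Reasoning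
    via : ∀ p → filter P? (a ∷ b ∷ []) ≡ p → NoAdjRepeat (p ++ a ∷ r) ⇔ NoAdjRepeat (a ∷ r) → Alternate a b (pad w) ⇔ Alternate a b w
    via p e equiv = ⇔.trans (⇔.trans (≡⇒⇔ (cong NoAdjRepeat (trans restrict-pad (cong (_++ a ∷ r) e)))) equiv) (≡⇒⇔ (cong NoAdjRepeat (sym w≡ar)))
      where
      ≡⇒⇔ : ∀ {A B : Set} → A ≡ B → A ⇔ B
      ≡⇒⇔ refl = ⇔.refl
    by-cases : Dec (count a w < K) → Dec (count b w < K) → Alternate a b (pad w) ⇔ Alternate a b w
    by-cases (yes a<K) (yes b<K) = via (a ∷ b ∷ []) (trans (filter-accept P? {xs = b ∷ []} a<K) (cong (a ∷_) (filter-accept P? {xs = []} b<K)))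
      (mk⇔ (λ alt → NoAdjRepeat-tail (NoAdjRepeat-tail alt)) (λ alt → cons a b _ a≢b (cons b a r (≢-sym a≢b) alt)))
    by-cases (yes a<K) (no b≮K) = via (a ∷ []) (trans (filter-accept P? {xs = b ∷ []} a<K) (cong (a ∷_) (filter-reject P? {xs = []} b≮K)))
      (mk⇔ (λ { (cons _ _ _ a≢a _) → ⊥-elim (a≢a refl) })
           (λ alt → ⊥-elim (b≮K (≤-<-trans (proj₁ (alternate-balanced w a≢b (subst NoAdjRepeat (sym w≡ar) alt) a-first)) a<K))))
    by-cases (no a≮K) (yes b<K) = via (b ∷ []) (trans (filter-reject P? {xs = b ∷ []} a≮K) (filter-accept P? {xs = []} b<K))
      (mk⇔ NoAdjRepeat-tail (cons b a r (≢-sym a≢b)))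
    by-cases (no a≮K) (no b≮K) = via [] (trans (filter-reject P? {xs = b ∷ []} a≮K) (filter-reject P? {xs = []} b≮K)) ⇔.refl

  alternate-pad : ∀ {x y} (w : Word n) → Bounded w → x ≢ y → Alternate x y (pad w) ⇔ Alternate x y w
  alternate-pad {x} {y} w bounded x≢y
    with restrict-initialPermutation w x≢y (count>0⇒∈ w (proj₁ (bounded x))) (count>0⇒∈ w (proj₁ (bounded y)))
  ... | inj₁ π≡xy = alternate-pad-ordered w bounded x≢y π≡xy
  ... | inj₂ π≡yx = ⇔.trans (swap (pad w)) (⇔.trans (alternate-pad-ordered w bounded (≢-sym x≢y) (trans (restrict-comm y x (initialPermutation w)) π≡yx)) (swap w))
    where
    swap : ∀ {a b} v → Alternate a b v ⇔ Alternate b a v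
    swap {a} {b} v = mk⇔ (Alternate-sym a b v) (Alternate-sym b a v)

  Bounded-pad : ∀ (w : Word n) → Bounded w → Bounded (pad w)
  Bounded-pad w bounded v with count v w <? K
  ... | yes cv<K rewrite count-pad-< w (count>0⇒∈ w (proj₁ (bounded v))) cv<K = s≤s z≤n , cv<K
  ... | no cv≮K rewrite count-pad-≥ w cv≮K = bounded v

  pad^ : ℕ → Word n → Word n
  pad^ zero w = w
  pad^ (suc f) w = pad^ f (pad w)

  pad^-uniform : ∀ f (w : Word n) → Bounded w → (∀ v → K ≤ count v w + f) → ∀ v → count v (pad^ f w) ≡ K
  pad^-uniform zero w bounded K≤ v = ≤-antisym (proj₂ (bounded v)) (subst (K ≤_) (+-identityʳ _) (K≤ v))
  pad^-uniform (suc f) w bounded K≤ = pad^-uniform f (pad w) (Bounded-pad w bounded) K≤′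
    where
    K≤′ : ∀ v → K ≤ count v (pad w) + f
    K≤′ v with count v w <? K
    ... | yes cv<K rewrite count-pad-< w (count>0⇒∈ w (proj₁ (bounded v))) cv<K = subst (K ≤_) (+-suc _ f) (K≤ v)
    ... | no cv≮K rewrite count-pad-≥ w cv≮K = ≤-trans (≮⇒≥ cv≮K) (m≤m+n _ f)

  alternate-pad^ : ∀ f {x y} (w : Word n) → Bounded w → x ≢ y → Alternate x y (pad^ f w) ⇔ Alternate x y w
  alternate-pad^ zero w bounded x≢y = ⇔.refl
  alternate-pad^ (suc f) w bounded x≢y =
    ⇔.trans (alternate-pad^ f (pad w) (Bounded-pad w bounded) x≢y) (alternate-pad w bounded x≢y)

uniformise : ∀ {n} {G : Graph n} (w : Word n) → Represents w G → ∃[ K ] KRepresentable K G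
uniformise {n} {G} w (w-covers , w-represents) = K , pad^ K K w , uniform , covers , represents
  where
  K = length w
  bounded : Bounded K w
  bounded v = ∈⇒count>0 (w-covers v) , length-filter (_≟ v) w
  uniform : ∀ v → count v (pad^ K K w) ≡ K
  uniform = pad^-uniform K K w bounded (λ v → m≤n+m K (count v w))
  covers : ∀ v → v ∈ pad^ K K w
  covers v = count>0⇒∈ _ (subst (0 <_) (sym (uniform v)) (≤-trans (proj₁ (bounded v)) (proj₂ (bounded v))))
  represents : ∀ x y → x ≢ y → Alternate x y (pad^ K K w) ⇔ Adj G x y
  represents x y x≢y = ⇔.trans (alternate-pad^ K K w bounded x≢y) (w-represents x y x≢y)

indicator : {P : Set} → Dec P → ℕ
indicator d = if does d then 1 else 0

sum-mono : ∀ {n} {f g : Fin n → ℕ} → (∀ i → f i ≤ g i) → sum f ≤ sum g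
sum-mono {zero} f≤g = z≤n
sum-mono {suc n} f≤g = +-mono-≤ (f≤g zero) (sum-mono (λ i → f≤g (suc i)))

sum-indicator-≡ : ∀ {n} (a : Fin n) → sum (λ i → indicator (i ≟ a)) ≡ 1
sum-indicator-≡ {suc n} zero = cong suc (sum-replicate-zero n)
sum-indicator-≡ {suc n} (suc a) = sum-indicator-≡ {n} a

module _ {n : ℕ} {P : Pred (Fin n) 0ℓ} (P? : Decidable P) where

  sum-indicator-* : ∀ (a : Fin n) → sum (λ v → indicator (P? v) * indicator (v ≟ a)) ≡ indicator (P? a)
  sum-indicator-* a = begin
    sum (λ v → indicator (P? v) * indicator (v ≟ a))  ≡⟨ sum-cong-≗ only-a ⟩
    sum (λ v → indicator (P? a) * indicator (v ≟ a))  ≡⟨ *-distribˡ-sum (indicator (P? a)) (λ v → indicator (v ≟ a)) ⟨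
    indicator (P? a) * sum (λ v → indicator (v ≟ a))  ≡⟨ cong (indicator (P? a) *_) (sum-indicator-≡ a) ⟩
    indicator (P? a) * 1                              ≡⟨ *-identityʳ _ ⟩
    indicator (P? a)                                  ∎
    where
    open ≡-Reasoning
    only-a : ∀ v → indicator (P? v) * indicator (v ≟ a) ≡ indicator (P? a) * indicator (v ≟ a)
    only-a v with v ≟ a
    ... | yes refl = refl
    ... | no _ = trans (*-zeroʳ (indicator (P? v))) (sym (*-zeroʳ (indicator (P? a))))

  length-filter-sum : (w : Word n) → length (filter P? w) ≡ sum (λ v → indicator (P? v) * count v w)
  length-filter-sum [] = sym (trans (sum-cong-≗ (λ v → *-zeroʳ (indicator (P? v)))) (sum-replicate-zero n))
  length-filter-sum (a ∷ w) = begin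
    length (filter P? (a ∷ w))                                       ≡⟨ length-filter-∷ ⟩
    indicator (P? a) + length (filter P? w)                          ≡⟨ cong₂ _+_ (sum-indicator-* a) (sym (length-filter-sum w)) ⟨
    sum (λ v → indicator (P? v) * indicator (v ≟ a)) + sum (λ v → indicator (P? v) * count v w)
                                                                      ≡⟨ ∑-distrib-+ (λ v → indicator (P? v) * indicator (v ≟ a)) (λ v → indicator (P? v) * count v w) ⟨
    sum (λ v → indicator (P? v) * indicator (v ≟ a) + indicator (P? v) * count v w)
                                                                      ≡⟨ sum-cong-≗ (λ v → sym (trans (cong (indicator (P? v) *_) (count-∷ v)) (*-distribˡ-+ (indicator (P? v)) _ _))) ⟩
    sum (λ v → indicator (P? v) * count v (a ∷ w))                   ∎
    where
    open ≡-Reasoning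
    length-filter-∷ : length (filter P? (a ∷ w)) ≡ indicator (P? a) + length (filter P? w)
    length-filter-∷ with P? a
    ... | yes _ = refl
    ... | no _ = refl
    count-∷ : ∀ v → count v (a ∷ w) ≡ indicator (v ≟ a) + count v w
    count-∷ v with v ≟ a
    ... | yes refl = count-∷-≡ v w
    ... | no v≢a = count-∷-≢ w (≢-sym v≢a)

module Clique {n : ℕ} {B : Pred (Fin n) 0ℓ} (B? : Decidable B) (u : Word n)
              (B-alternate : ∀ y y′ → B y → B y′ → y ≢ y′ → Alternate y y′ u) where

  b : ℕ
  b = sum (λ v → indicator (B? v))

  countB : Word n → ℕ
  countB p = length (filter B? p)

  Precedes : Fin n → Fin n → Set
  Precedes y′ y = B y′ × y′ ≢ y × first y′ y u ≡ just y′

  precedes? : ∀ y′ y → Dec (Precedes y′ y)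
  precedes? y′ y = B? y′ ×-dec (¬? (y′ ≟ y) ×-dec Maybe.≡-dec _≟_ (first y′ y u) (just y′))

  rank : Fin n → ℕ
  rank y = sum (λ y′ → indicator (precedes? y′ y))

  module _ {y : Fin n} (y∈B : B y) (p s : Word n) (u≡ps : u ≡ p ++ s) where

    private
      balanced : ∀ {a c} → B a → B c → a ≢ c → first a c u ≡ just a → Balanced a c p
      balanced {a} {c} a∈B c∈B a≢c a-first = alternate-prefix-balanced a≢c p s
        (subst (Alternate a c) u≡ps (B-alternate a c a∈B c∈B a≢c)) (subst (λ w → first a c w ≡ just a) u≡ps a-first)

      count-prefix-zero : ∀ {z} → count z u ≡ 0 → count z p ≡ 0
      count-prefix-zero {z} cz≡0 = n≤0⇒n≡0 (subst (count z p ≤_) (trans (cong (count z) (sym u≡ps)) cz≡0) (count-prefix-≤ z p s))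

      upper-at : ∀ y′ → indicator (B? y′) * count y′ p ≤ indicator (B? y′) * count y p + indicator (precedes? y′ y)
      upper-at y′ with B? y′ | y′ ≟ y | Maybe.≡-dec _≟_ (first y′ y u) (just y′)
      ... | no _ | _ | _ = z≤n
      ... | yes _ | yes refl | _ = m≤m+n _ _
      ... | yes y′∈B | no y′≢y | yes y′-first rewrite +-identityʳ (count y′ p) | +-identityʳ (count y p) =
              subst (count y′ p ≤_) (+-comm 1 _) (proj₂ (balanced y′∈B y∈B y′≢y y′-first))
      ... | yes y′∈B | no y′≢y | no not-y′-first rewrite +-identityʳ (count y′ p) | +-identityʳ (count y p) with first-cases y′ y u
      ...   | inj₁ y′-first = ⊥-elim (not-y′-first y′-first)
      ...   | inj₂ (inj₁ y-first) = ≤-trans (proj₁ (balanced y∈B y′∈B (≢-sym y′≢y) (trans (cong head (restrict-comm y y′ u)) y-first))) (m≤m+n _ _)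
      ...   | inj₂ (inj₂ (cy′≡0 , _)) rewrite count-prefix-zero cy′≡0 = z≤n

      lower-at : ∀ y′ → indicator (B? y′) * count y p + indicator (precedes? y′ y) + indicator (y′ ≟ y) ≤ indicator (B? y′) * count y′ p + indicator (B? y′)
      lower-at y′ with B? y′ | y′ ≟ y | Maybe.≡-dec _≟_ (first y′ y u) (just y′)
      ... | no y∉B | yes refl | _ = ⊥-elim (y∉B y∈B)
      ... | no _ | no _ | _ = z≤n
      ... | yes _ | yes refl | _ = ≤-reflexive (cong (_+ 1) (+-identityʳ _))
      ... | yes y′∈B | no y′≢y | yes y′-first rewrite +-identityʳ (count y′ p) | +-identityʳ (count y p) | +-identityʳ (count y p + 1) =
              +-monoˡ-≤ 1 (proj₁ (balanced y′∈B y∈B y′≢y y′-first))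
      ... | yes y′∈B | no y′≢y | no not-y′-first
          rewrite +-identityʳ (count y′ p) | +-identityʳ (count y p) | +-identityʳ (count y p) | +-identityʳ (count y p)
          with first-cases y′ y u
      ...   | inj₁ y′-first = ⊥-elim (not-y′-first y′-first)
      ...   | inj₂ (inj₁ y-first) = subst (count y p ≤_) (+-comm 1 _) (proj₂ (balanced y∈B y′∈B (≢-sym y′≢y) (trans (cong head (restrict-comm y y′ u)) y-first)))
      ...   | inj₂ (inj₂ (_ , cy≡0)) rewrite count-prefix-zero cy≡0 = z≤n

    countB-upper : countB p ≤ b * count y p + rank y
    countB-upper = begin
      countB p                                                        ≡⟨ length-filter-sum B? p ⟩
      sum (λ y′ → indicator (B? y′) * count y′ p)                     ≤⟨ sum-mono upper-at ⟩
      sum (λ y′ → indicator (B? y′) * count y p + indicator (precedes? y′ y))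
                                                                      ≡⟨ ∑-distrib-+ (λ y′ → indicator (B? y′) * count y p) _ ⟩
      sum (λ y′ → indicator (B? y′) * count y p) + rank y             ≡⟨ cong (_+ rank y) (*-distribʳ-sum (count y p) (λ y′ → indicator (B? y′))) ⟨
      b * count y p + rank y                                          ∎
      where open ≤-Reasoning

    countB-lower : b * count y p + rank y < countB p + b
    countB-lower = begin-strict
      b * count y p + rank y                                          <⟨ m<m+n _ (s≤s z≤n) ⟩
      b * count y p + rank y + 1                                      ≡⟨ cong₂ (λ s t → s + rank y + t) (*-distribʳ-sum (count y p) (λ y′ → indicator (B? y′))) (sym (sum-indicator-≡ y)) ⟩
      sum (λ y′ → indicator (B? y′) * count y p) + rank y + sum (λ y′ → indicator (y′ ≟ y))
                                                                      ≡⟨ cong (_+ _) (∑-distrib-+ (λ y′ → indicator (B? y′) * count y p) _) ⟨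
      sum (λ y′ → indicator (B? y′) * count y p + indicator (precedes? y′ y)) + sum (λ y′ → indicator (y′ ≟ y))
                                                                      ≡⟨ ∑-distrib-+ (λ y′ → indicator (B? y′) * count y p + indicator (precedes? y′ y)) _ ⟨
      sum (λ y′ → indicator (B? y′) * count y p + indicator (precedes? y′ y) + indicator (y′ ≟ y))
                                                                      ≤⟨ sum-mono lower-at ⟩
      sum (λ y′ → indicator (B? y′) * count y′ p + indicator (B? y′)) ≡⟨ ∑-distrib-+ (λ y′ → indicator (B? y′) * count y′ p) _ ⟩
      sum (λ y′ → indicator (B? y′) * count y′ p) + b                 ≡⟨ cong (_+ b) (length-filter-sum B? p) ⟨
      countB p + b                                                    ∎
      where open ≤-Reasoning

  rank<b : ∀ {y} → B y → rank y < b
  rank<b {y} y∈B = subst (λ m → m + rank y < b) (*-zeroʳ b) (countB-lower y∈B [] u refl)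

private
  +-*-suc : ∀ j b t → j + b * t + b ≡ j + b * suc t
  +-*-suc = solve-∀

count-from-bounds : ∀ b j F c t → F ≤ b * c + j → b * c + j < F + b →
                    c ≡ t ⇔ (suc j + b * t ≤ F + b × F ≤ j + b * t)
count-from-bounds b j F c t upper lower = mk⇔ to from
  where
  open ≤-Reasoning
  to : c ≡ t → suc j + b * t ≤ F + b × F ≤ j + b * t
  to refl = subst (_≤ F + b) (cong suc (+-comm (b * c) j)) lower , subst (F ≤_) (+-comm (b * c) j) upper
  from : suc j + b * t ≤ F + b × F ≤ j + b * t → c ≡ t
  from (lower′ , upper′) = ≤-antisym c≤t t≤c
    where
    c≤t : c ≤ t
    c≤t = ≤-pred (*-cancelˡ-< b c (suc t) (+-cancelˡ-< j (b * c) (b * suc t) (begin-strict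
      j + b * c      ≡⟨ +-comm j (b * c) ⟩
      b * c + j      <⟨ lower ⟩
      F + b          ≤⟨ +-monoˡ-≤ b upper′ ⟩
      j + b * t + b  ≡⟨ +-*-suc j b t ⟩
      j + b * suc t  ∎)))
    t≤c : t ≤ c
    t≤c = ≤-pred (*-cancelˡ-< b t (suc c) (+-cancelˡ-< j (b * t) (b * suc c) (begin-strict
      j + b * t      <⟨ n<1+n _ ⟩
      suc j + b * t  ≤⟨ lower′ ⟩
      F + b          ≤⟨ +-monoˡ-≤ b upper ⟩
      b * c + j + b  ≡⟨ trans (cong (_+ b) (+-comm (b * c) j)) (+-*-suc j b c) ⟩
      j + b * suc c  ∎)))

count-from-bounds-suc : ∀ b j F c t → F ≤ b * c + j → b * c + j < F + b →
                        c ≡ suc t ⇔ (suc j + b * t ≤ F × F ≤ (j + b) + b * t)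
count-from-bounds-suc b j F c t upper lower = mk⇔
  (λ c≡1+t → let (l , u) = Equivalence.to equiv c≡1+t in +-cancelʳ-≤ b _ _ (subst (_≤ F + b) (shift-lower b j t) l) , subst (F ≤_) (shift-upper b j t) u)
  (λ (l , u) → Equivalence.from equiv (subst (_≤ F + b) (sym (shift-lower b j t)) (+-monoˡ-≤ b l) , subst (F ≤_) (sym (shift-upper b j t)) u))
  where
  equiv = count-from-bounds b j F c (suc t) upper lower
  shift-lower : ∀ b j t → suc j + b * suc t ≡ suc j + b * t + b
  shift-lower = solve-∀
  shift-upper : ∀ b j t → j + b * suc t ≡ (j + b) + b * t
  shift-upper = solve-∀

-≤-⇔ : ∀ a c d e → (+ a - + c ≤ℤ + d - + e) ⇔ (a + e ≤ d + c)
-≤-⇔ a c d e = mk⇔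
  (λ h → ℤ.drop‿+≤+ (subst₂ _≤ℤ_ (k₁ (+ a) (+ c) (+ e)) (k₂ (+ d) (+ c) (+ e)) (ℤ.+-monoˡ-≤ (+ c +ℤ + e) h)))
  (λ h → subst₂ _≤ℤ_ (k₃ (+ a) (+ c) (+ e)) (k₄ (+ d) (+ c) (+ e)) (ℤ.+-monoˡ-≤ (- (+ c +ℤ + e)) (+≤+ h)))
  where
  k₁ : ∀ A C E → (A - C) +ℤ (C +ℤ E) ≡ A +ℤ E
  k₁ = ℤ-Solver.solve-∀
  k₂ : ∀ D C E → (D - E) +ℤ (C +ℤ E) ≡ D +ℤ C
  k₂ = ℤ-Solver.solve-∀
  k₃ : ∀ A C E → (A +ℤ E) - (C +ℤ E) ≡ A - C
  k₃ = ℤ-Solver.solve-∀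
  k₄ : ∀ D C E → (D +ℤ C) - (C +ℤ E) ≡ D - E
  k₄ = ℤ-Solver.solve-∀

-≤⇔ : ∀ F m k → (+ F - + m ≤ℤ + k) ⇔ (F ≤ k + m)
-≤⇔ F m k = mk⇔
  (λ h → ℤ.drop‿+≤+ (subst (_≤ℤ + (k + m)) (k₁ (+ F) (+ m)) (ℤ.+-monoˡ-≤ (+ m) h)))
  (λ h → subst (+ F - + m ≤ℤ_) (k₂ (+ k) (+ m)) (ℤ.+-monoˡ-≤ (- + m) (+≤+ h)))
  where
  k₁ : ∀ X M → (X - M) +ℤ M ≡ X
  k₁ = ℤ-Solver.solve-∀
  k₂ : ∀ X M → (X +ℤ M) - M ≡ X
  k₂ = ℤ-Solver.solve-∀

≤-⇔ : ∀ k F m → (+ k ≤ℤ + F - + m) ⇔ (k + m ≤ F)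
≤-⇔ k F m = mk⇔
  (λ h → ℤ.drop‿+≤+ (subst (+ (k + m) ≤ℤ_) (k₁ (+ F) (+ m)) (ℤ.+-monoˡ-≤ (+ m) h)))
  (λ h → subst (_≤ℤ + F - + m) (k₂ (+ k) (+ m)) (ℤ.+-monoˡ-≤ (- + m) (+≤+ h)))
  where
  k₁ : ∀ X M → (X - M) +ℤ M ≡ X
  k₁ = ℤ-Solver.solve-∀
  k₂ : ∀ X M → (X +ℤ M) - M ≡ X
  k₂ = ℤ-Solver.solve-∀

InWindow : ℤ → ℤ → ℤ → Set
InWindow lo hi z = lo ≤ℤ z × z ≤ℤ hi

count-window₀ : ∀ b j F c t → F ≤ b * c + j → b * c + j < F + b →
                c ≡ t ⇔ InWindow (+ suc j - + b) (+ j) (+ F - + (b * t))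
count-window₀ b j F c t upper lower = mk⇔
  (λ c≡t → let (l , u) = Equivalence.to equiv c≡t in Equivalence.from (-≤-⇔ (suc j) b F (b * t)) l , Equivalence.from (-≤⇔ F (b * t) j) u)
  (λ (l , u) → Equivalence.from equiv (Equivalence.to (-≤-⇔ (suc j) b F (b * t)) l , Equivalence.to (-≤⇔ F (b * t) j) u))
  where equiv = count-from-bounds b j F c t upper lower

count-window₁ : ∀ b j F c t → F ≤ b * c + j → b * c + j < F + b →
                c ≡ suc t ⇔ InWindow (+ suc j) (+ (j + b)) (+ F - + (b * t))
count-window₁ b j F c t upper lower = mk⇔
  (λ c≡1+t → let (l , u) = Equivalence.to equiv c≡1+t in Equivalence.from (≤-⇔ (suc j) F (b * t)) l , Equivalence.from (-≤⇔ F (b * t) (j + b)) u)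
  (λ (l , u) → Equivalence.from equiv (Equivalence.to (≤-⇔ (suc j) F (b * t)) l , Equivalence.to (-≤⇔ F (b * t) (j + b)) u))
  where equiv = count-from-bounds-suc b j F c t upper lower

module Window {n : ℕ} {B : Pred (Fin n) 0ℓ} (B? : Decidable B) (u : Word n)
              (B-alternate : ∀ y y′ → B y → B y′ → y ≢ y′ → Alternate y y′ u) where

  open Clique B? u B-alternate public

  φ : Fin n → Word n → ℤ
  φ x p = + countB p - + (b * count x p)

  profile : Fin n → List ℤ
  profile x = map (φ x) (prefixesBefore x u)

  Window : ℕ → List ℤ → Set
  Window j zs = All (InWindow (+ suc j) (+ (j + b))) zs ⊎ All (InWindow (+ suc j - + b) (+ j)) zs

  private
    along-prefixes : ∀ {Q R : Word n → Set} x → (∀ {p s} → u ≡ p ++ s → Q p → R p) →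
                     All Q (prefixesBefore x u) → All R (prefixesBefore x u)
    along-prefixes x f qs = All.zipWith (λ ((_ , u≡) , q) → f u≡ q) (prefixesBefore-split x u , qs)

  alternate⇔Window : ∀ {x y} → ¬ B x → B y → count x u ≡ count y u → Alternate x y u ⇔ Window (rank y) (profile x)
  alternate⇔Window {x} {y} x∉B y∈B cx≡cy = mk⇔ to from
    where
    x≢y : x ≢ y
    x≢y refl = x∉B y∈B
    window₀ : ∀ {p s} → u ≡ p ++ s → count y p ≡ count x p ⇔ InWindow (+ suc (rank y) - + b) (+ rank y) (φ x p)
    window₀ {p} {s} u≡ = count-window₀ b (rank y) (countB p) (count y p) (count x p) (countB-upper y∈B p s u≡) (countB-lower y∈B p s u≡)
    window₁ : ∀ {p s} → u ≡ p ++ s → count y p ≡ suc (count x p) ⇔ InWindow (+ suc (rank y)) (+ (rank y + b)) (φ x p)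
    window₁ {p} {s} u≡ = count-window₁ b (rank y) (countB p) (count y p) (count x p) (countB-upper y∈B p s u≡) (countB-lower y∈B p s u≡)
    to : Alternate x y u → Window (rank y) (profile x)
    to alt with first-cases x y u
    ... | inj₁ x-first = inj₂ (All.map⁺ (along-prefixes x (λ {p} {s} u≡ → Equivalence.to (window₀ {p} {s} u≡)) (alternate⇒Lead₀ u x≢y alt x-first)))
    ... | inj₂ (inj₁ y-first) = inj₁ (All.map⁺ (along-prefixes x (λ {p} {s} u≡ → Equivalence.to (window₁ {p} {s} u≡)) (alternate⇒Lead₁ u x≢y alt y-first)))
    ... | inj₂ (inj₂ (cx≡0 , _)) rewrite prefixesBefore-absent x u cx≡0 = inj₁ []
    from : Window (rank y) (profile x) → Alternate x y u
    from (inj₁ window) = Lead⇒alternate u x≢y cx≡cy (inj₂ (along-prefixes x (λ {p} {s} u≡ → Equivalence.from (window₁ {p} {s} u≡)) (All.map⁻ window)))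
    from (inj₂ window) = Lead⇒alternate u x≢y cx≡cy (inj₁ (along-prefixes x (λ {p} {s} u≡ → Equivalence.from (window₀ {p} {s} u≡)) (All.map⁻ window)))

φ-≤-φ : ∀ F₁ m₁ F₂ m₂ c → F₁ + m₂ ≤ F₂ + c + m₁ → + F₁ - + m₁ ≤ℤ (+ F₂ - + m₂) +ℤ + c
φ-≤-φ F₁ m₁ F₂ m₂ c h = subst (+ F₁ - + m₁ ≤ℤ_) (shift (+ F₂) (+ m₂) (+ c)) (Equivalence.from (-≤-⇔ F₁ m₁ (F₂ + c) m₂) h)
  where
  shift : ∀ X M C → (X +ℤ C) - M ≡ (X - M) +ℤ C
  shift = ℤ-Solver.solve-∀

countB-++ : ∀ {n} {B : Pred (Fin n) 0ℓ} (B? : Decidable B) (p r : Word n) → length (filter B? p) ≤ length (filter B? (p ++ r))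
countB-++ B? p r rewrite filter-++ B? p r | length-++ (filter B? p) {filter B? r} = m≤m+n _ _

module Profiles {n : ℕ} {B : Pred (Fin n) 0ℓ} (B? : Decidable B) (u : Word n)
                (B-alternate : ∀ y y′ → B y → B y′ → y ≢ y′ → Alternate y y′ u)
                (A-alternate : ∀ x x′ → ¬ B x → ¬ B x′ → x ≢ x′ → Alternate x x′ u)
                (k : ℕ) (uniform : ∀ v → count v u ≡ suc k) where

  open Window B? u B-alternate public

  low high : Fin n → ℤ
  low x = min (+ b) (profile x)
  high x = max (+ 0) (profile x)

  countB-u : countB u ≡ b + b * k
  countB-u = begin
    countB u                                  ≡⟨ length-filter-sum B? u ⟩
    sum (λ v → indicator (B? v) * count v u)  ≡⟨ sum-cong-≗ (λ v → cong (indicator (B? v) *_) (uniform v)) ⟩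
    sum (λ v → indicator (B? v) * suc k)      ≡⟨ *-distribʳ-sum (suc k) (λ v → indicator (B? v)) ⟨
    b * suc k                                 ≡⟨ *-suc b k ⟩
    b + b * k                                 ∎
    where open ≡-Reasoning

  prefix-with-count : ∀ x t → t < suc k → Any (λ p → count x p ≡ t × ∃ λ r → u ≡ p ++ r) (prefixesBefore x u)
  prefix-with-count x t t<1+k = subst (Any _) (cong (prefixesBefore x) (++-identityʳ u))
    (prefixBefore-within x u [] t (subst (t <_) (sym (uniform x)) t<1+k))

  φ-last : ∀ x p {r} → u ≡ p ++ r → count x p ≡ k → φ x p ≤ℤ + b
  φ-last x p {r} u≡pr cx≡k rewrite cx≡k = Equivalence.from (-≤⇔ (countB p) (b * k) b)
    (subst (countB p ≤_) (trans (cong countB (sym u≡pr)) countB-u) (countB-++ B? p r))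

  φ-first : ∀ x p → count x p ≡ 0 → + 0 ≤ℤ φ x p
  φ-first x p cx≡0 rewrite cx≡0 | *-zeroʳ b = Equivalence.from (≤-⇔ 0 (countB p) 0) z≤n

  low≤b : ∀ x → low x ≤ℤ + b
  low≤b x = Extrema.min≤⊤ (+ b) (profile x)

  0≤high : ∀ x → + 0 ≤ℤ high x
  0≤high x = Extrema.v≤max⁺ (+ 0) (profile x) (inj₁ ℤ.≤-refl)

  low≤high : ∀ x → low x ≤ℤ high x
  low≤high x with All.lookupAny (All.zip (Extrema.min≤xs (+ b) (profile x) , Extrema.xs≤max (+ 0) (profile x))) nonempty
    where
    nonempty : Any (λ _ → ⊤) (profile x)
    nonempty = Any.map⁺ (Any.map _ (prefix-with-count x 0 (s≤s z≤n)))
  ... | (low≤z , z≤high) , _ = ℤ.≤-trans low≤z z≤high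

  φ-≤-prefix : ∀ x x′ {p} p′ r c → p ≡ p′ ++ r → b * count x p ≤ c + b * count x′ p′ → φ x′ p′ ≤ℤ φ x p +ℤ + c
  φ-≤-prefix x x′ {p} p′ r c p≡ counts = φ-≤-φ (countB p′) (b * count x′ p′) (countB p) (b * count x p) c (begin
    countB p′ + b * count x p        ≤⟨ +-mono-≤ (subst (λ q → countB p′ ≤ countB q) (sym p≡) (countB-++ B? p′ r)) counts ⟩
    countB p + (c + b * count x′ p′) ≡⟨ +-assoc (countB p) c _ ⟨
    countB p + c + b * count x′ p′   ∎)
    where open ≤-Reasoning

  private
    first-either : ∀ x x′ → first x x′ u ≡ just x ⊎ first x x′ u ≡ just x′
    first-either x x′ with first-cases x x′ u
    ... | inj₁ x-first = inj₁ x-first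
    ... | inj₂ (inj₁ x′-first) = inj₂ x′-first
    ... | inj₂ (inj₂ (cx≡0 , _)) with trans (sym (uniform x)) cx≡0
    ...   | ()

    along-prefixes : ∀ {Q R : Word n → Set} x → (∀ {p s} → u ≡ p ++ x ∷ s → Q p → R p) →
                     All Q (prefixesBefore x u) → All R (prefixesBefore x u)
    along-prefixes x f qs = All.zipWith (λ ((_ , u≡) , q) → f u≡ q) (prefixesBefore-split x u , qs)

    interleaving : ∀ {x x′} → ¬ B x → ¬ B x′ → x ≢ x′ →
                  All (λ p → count x p ≤ count x′ p × count x′ p ≤ suc (count x p)) (prefixesBefore x u)
    interleaving {x} {x′} x∉B x′∉B x≢x′ with first-either x x′
    ... | inj₁ x-first = All.map (λ e → ≤-reflexive (sym e) , ≤-trans (≤-reflexive e) (n≤1+n _))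
                           (alternate⇒Lead₀ u x≢x′ (A-alternate x x′ x∉B x′∉B x≢x′) x-first)
    ... | inj₂ x′-first = All.map (λ e → ≤-trans (n≤1+n _) (≤-reflexive (sym e)) , ≤-reflexive e)
                            (alternate⇒Lead₁ u x≢x′ (A-alternate x x′ x∉B x′∉B x≢x′) x′-first)

  low-step : ∀ {x x′} → ¬ B x → ¬ B x′ → low x′ ≤ℤ low x +ℤ + b
  low-step {x} {x′} x∉B x′∉B with x ≟ x′
  ... | yes refl = ℤ.i≤i+j (low x) (+ b)
  ... | no x≢x′ = Extrema.argmin-all id {P = λ z → low x′ ≤ℤ z +ℤ + b}
        (ℤ.≤-trans (low≤b x′) (ℤ.i≤i+j (+ b) (+ b)))
        (All.map⁺ (along-prefixes x (λ u≡ bounds → Extrema.min≤v⁺ (+ b) (profile x′) (inj₂ (Any.map⁺ (witness u≡ bounds))))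
                    (interleaving x∉B x′∉B x≢x′)))
    where
    witness : ∀ {p s} → u ≡ p ++ x ∷ s → count x p ≤ count x′ p × count x′ p ≤ suc (count x p) →
              Any (λ p′ → φ x′ p′ ≤ℤ φ x p +ℤ + b) (prefixesBefore x′ u)
    witness {p} {s} u≡ (cx≤cx′ , _) = by-count (count x p) refl
      where
      by-count : ∀ t → count x p ≡ t → Any (λ p′ → φ x′ p′ ≤ℤ φ x p +ℤ + b) (prefixesBefore x′ u)
      by-count zero cx≡0 = Any.map last (prefix-with-count x′ k (n<1+n k))
        where
        last : ∀ {p′} → count x′ p′ ≡ k × ∃ (λ r → u ≡ p′ ++ r) → φ x′ p′ ≤ℤ φ x p +ℤ + b
        last {p′} (cx′≡k , _ , u≡′) = ℤ.≤-trans (φ-last x′ p′ u≡′ cx′≡k)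
          (subst (_≤ℤ φ x p +ℤ + b) (ℤ.+-identityˡ (+ b)) (ℤ.+-monoˡ-≤ (+ b) (φ-first x p cx≡0)))
      by-count (suc t) cx≡1+t = subst (Any _) (cong (prefixesBefore x′) (sym u≡)) (Any.map earlier
        (prefixBefore-within x′ p (x ∷ s) t (subst (_≤ count x′ p) cx≡1+t cx≤cx′)))
        where
        earlier : ∀ {p′} → count x′ p′ ≡ t × ∃ (λ r → p ≡ p′ ++ r) → φ x′ p′ ≤ℤ φ x p +ℤ + b
        earlier {p′} (cx′≡t , r , p≡) = φ-≤-prefix x x′ p′ r b p≡ (≤-reflexive (begin
          b * count x p         ≡⟨ cong (b *_) cx≡1+t ⟩
          b * suc t             ≡⟨ *-suc b t ⟩
          b + b * t             ≡⟨ cong (λ c → b + b * c) cx′≡t ⟨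
          b + b * count x′ p′   ∎))
          where open ≡-Reasoning

  private
    count-before-u : ∀ x {p s} → u ≡ p ++ x ∷ s → count x p < suc k
    count-before-u x {p} {s} u≡ = subst (count x p <_) (trans (cong (count x) (sym u≡)) (uniform x)) (count-before x p s)

  high-step : ∀ {x x′} → ¬ B x → ¬ B x′ → high x′ ≤ℤ high x +ℤ + b
  high-step {x} {x′} x∉B x′∉B with x ≟ x′
  ... | yes refl = ℤ.i≤i+j (high x) (+ b)
  ... | no x≢x′ = Extrema.max≤v⁺ (ℤ.≤-trans (0≤high x) (ℤ.i≤i+j (high x) (+ b)))
        (All.map⁺ (along-prefixes x′ (λ {p′} u≡ bounds → All.lookupWith (λ z≤high φ′≤z → ℤ.≤-trans φ′≤z (ℤ.+-monoˡ-≤ (+ b) z≤high))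
                                                          (Extrema.xs≤max (+ 0) (profile x)) (Any.map⁺ (witness u≡ bounds)))
                    (interleaving x′∉B x∉B (≢-sym x≢x′))))
    where
    witness : ∀ {p′ s} → u ≡ p′ ++ x′ ∷ s → count x′ p′ ≤ count x p′ × count x p′ ≤ suc (count x′ p′) →
              Any (λ p → φ x′ p′ ≤ℤ φ x p +ℤ + b) (prefixesBefore x u)
    witness {p′} {s} u≡ (_ , cx≤1+cx′) with m≤n⇒m<n∨m≡n (≤-pred (count-before-u x′ u≡))
    ... | inj₂ cx′≡k = Any.map initial (prefix-with-count x 0 (s≤s z≤n))
      where
      initial : ∀ {p} → count x p ≡ 0 × ∃ (λ r → u ≡ p ++ r) → φ x′ p′ ≤ℤ φ x p +ℤ + b
      initial {p} (cx≡0 , _) = ℤ.≤-trans (φ-last x′ p′ u≡ cx′≡k)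
        (subst (_≤ℤ φ x p +ℤ + b) (ℤ.+-identityˡ (+ b)) (ℤ.+-monoˡ-≤ (+ b) (φ-first x p cx≡0)))
    ... | inj₁ cx′<k = subst (Any _) (cong (prefixesBefore x) (sym u≡)) (Any.map later
        (prefixBefore-beyond x p′ (x′ ∷ s) (suc (count x′ p′)) cx≤1+cx′ (subst (suc (count x′ p′) <_) (trans (sym (uniform x)) (cong (count x) u≡)) (s≤s cx′<k))))
      where
      later : ∀ {p} → count x p ≡ suc (count x′ p′) × ∃ (λ r → p ≡ p′ ++ r) → φ x′ p′ ≤ℤ φ x p +ℤ + b
      later {p} (cx≡ , r , p≡) = φ-≤-prefix x x′ p′ r b p≡ (≤-reflexive (trans (cong (b *_) cx≡) (*-suc b _)))

  low-ordered : ∀ {x x′} → ¬ B x → ¬ B x′ → x ≢ x′ → first x x′ u ≡ just x → low x ≤ℤ low x′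
  low-ordered {x} {x′} x∉B x′∉B x≢x′ x-first = Extrema.min[xs]≤min[ys]⁺ (+ b) (profile x) (inj₁ ℤ.≤-refl)
    (All.map⁺ (along-prefixes x′ (λ u≡ lead → inj₂ (Any.map⁺ (witness u≡ lead)))
      (alternate⇒Lead₁ u (≢-sym x≢x′) (A-alternate x′ x x′∉B x∉B (≢-sym x≢x′)) (trans (cong head (restrict-comm x′ x u)) x-first))))
    where
    witness : ∀ {p′ s} → u ≡ p′ ++ x′ ∷ s → count x p′ ≡ suc (count x′ p′) → Any (λ p → φ x p ≤ℤ φ x′ p′) (prefixesBefore x u)
    witness {p′} {s} u≡ cx≡ = subst (Any _) (cong (prefixesBefore x) (sym u≡)) (Any.map earlier
      (prefixBefore-within x p′ (x′ ∷ s) (count x′ p′) (≤-reflexive (sym cx≡))))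
      where
      earlier : ∀ {p} → count x p ≡ count x′ p′ × ∃ (λ r → p′ ≡ p ++ r) → φ x p ≤ℤ φ x′ p′
      earlier {p} (cx≡cx′ , r , p′≡) = subst (φ x p ≤ℤ_) (ℤ.+-identityʳ (φ x′ p′))
        (φ-≤-prefix x′ x p r 0 p′≡ (≤-reflexive (cong (b *_) (sym cx≡cx′))))

  high-ordered : ∀ {x x′} → ¬ B x → ¬ B x′ → x ≢ x′ → first x x′ u ≡ just x → high x ≤ℤ high x′
  high-ordered {x} {x′} x∉B x′∉B x≢x′ x-first = Extrema.max[xs]≤max[ys]⁺ (+ 0) (profile x′) (inj₁ ℤ.≤-refl)
    (All.map⁺ (along-prefixes x (λ u≡ lead → inj₂ (Any.map⁺ (witness u≡ lead)))
      (alternate⇒Lead₀ u x≢x′ (A-alternate x x′ x∉B x′∉B x≢x′) x-first)))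
    where
    witness : ∀ {p s} → u ≡ p ++ x ∷ s → count x′ p ≡ count x p → Any (λ p′ → φ x p ≤ℤ φ x′ p′) (prefixesBefore x′ u)
    witness {p} {s} u≡ cx′≡cx = subst (Any _) (cong (prefixesBefore x′) (sym u≡)) (Any.map later
      (prefixBefore-beyond x′ p (x ∷ s) (count x p) (≤-reflexive cx′≡cx)
        (subst (count x p <_) (sym (trans (cong (count x′) (sym u≡)) (uniform x′))) (count-before-u x u≡))))
      where
      later : ∀ {p′} → count x′ p′ ≡ count x p × ∃ (λ r → p′ ≡ p ++ r) → φ x p ≤ℤ φ x′ p′
      later {p′} (cx′≡cx , r , p′≡) = subst (φ x p ≤ℤ_) (ℤ.+-identityʳ (φ x′ p′))
        (φ-≤-prefix x′ x p r 0 p′≡ (≤-reflexive (cong (b *_) cx′≡cx)))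

  window-profile : ∀ {lo hi} x → lo ≤ℤ + b → + 0 ≤ℤ hi → All (InWindow lo hi) (profile x) ⇔ (lo ≤ℤ low x × high x ≤ℤ hi)
  window-profile x lo≤b 0≤hi = mk⇔
    (λ within → Extrema.v≤min⁺ lo≤b (All.map proj₁ within) , Extrema.max≤v⁺ 0≤hi (All.map proj₂ within))
    (λ (lo≤low , high≤hi) → All.zipWith (λ (low≤z , z≤high) → ℤ.≤-trans lo≤low low≤z , ℤ.≤-trans z≤high high≤hi)
                              (Extrema.min≤xs (+ b) (profile x) , Extrema.xs≤max (+ 0) (profile x)))

module Rounds (b : ℕ) where

  round₀ : ℤ → ℤ
  round₀ L = L ⊔ + 0

  round₁ : ℤ → ℤ → ℤ
  round₁ L H with H ≤? + b
  ... | yes _ = L ⊔ - + b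
  ... | no _ = H ⊓ + (b + b)

  round₂ : ℤ → ℤ
  round₂ H = H ⊓ + b

  rounds : ℤ → ℤ → List ℤ
  rounds L H = round₀ L ∷ round₁ L H ∷ round₂ H ∷ []

  private
    0≤b : + 0 ≤ℤ + b
    0≤b = +≤+ z≤n
    -b≤0 : - + b ≤ℤ + 0
    -b≤0 = ℤ.neg-≤-pos
    b≤b+b : + b ≤ℤ + (b + b)
    b≤b+b = +≤+ (m≤m+n b b)

  module _ {j : ℕ} (j<b : j < b) {L H : ℤ} (L≤H : L ≤ℤ H) where

    private
      1+j≰0 : ¬ (+ suc j ≤ℤ + 0)
      1+j≰0 (+≤+ ())
      b+b≰j+b : ¬ (+ (b + b) ≤ℤ + (j + b))
      b+b≰j+b (+≤+ le) = <⇒≱ j<b (+-cancelʳ-≤ b b j le)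
      b+b≰j : ¬ (+ (b + b) ≤ℤ + j)
      b+b≰j (+≤+ le) = <⇒≱ j<b (≤-trans (m≤m+n b b) le)
      1+j≤b : + suc j ≤ℤ + b
      1+j≤b = +≤+ j<b

    rounds-window₁ : All (InWindow (+ suc j) (+ (j + b))) (rounds L H) ⇔ (+ suc j ≤ℤ L × H ≤ℤ + (j + b))
    rounds-window₁ = mk⇔ to from
      where
      lo = + suc j
      hi = + (j + b)
      0≤hi : + 0 ≤ℤ hi
      0≤hi = +≤+ z≤n
      to : All (InWindow lo hi) (rounds L H) → lo ≤ℤ L × H ≤ℤ hi
      to (r₀ ∷ r₁ ∷ r₂ ∷ []) = lo≤L , H≤hi r₁ r₂
        where
        lo≤L : lo ≤ℤ L
        lo≤L with ℤ.⊔-sel L (+ 0)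
        ... | inj₁ e = subst (lo ≤ℤ_) e (proj₁ r₀)
        ... | inj₂ e = ⊥-elim (1+j≰0 (subst (lo ≤ℤ_) e (proj₁ r₀)))
        H≤hi : InWindow lo hi (round₁ L H) → InWindow lo hi (round₂ H) → H ≤ℤ hi
        H≤hi r₁ r₂ with H ≤? + b
        ... | yes H≤b = subst (_≤ℤ hi) (ℤ.i≤j⇒i⊓j≡i H≤b) (proj₂ r₂)
        ... | no _ with ℤ.⊓-sel H (+ (b + b))
        ...   | inj₁ e = subst (_≤ℤ hi) e (proj₂ r₁)
        ...   | inj₂ e = ⊥-elim (b+b≰j+b (subst (_≤ℤ hi) e (proj₂ r₁)))
      from : lo ≤ℤ L × H ≤ℤ hi → All (InWindow lo hi) (rounds L H)
      from (lo≤L , H≤hi) = r₀ ∷ r₁ ∷ r₂ ∷ []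
        where
        L≤hi = ℤ.≤-trans L≤H H≤hi
        lo≤H = ℤ.≤-trans lo≤L L≤H
        r₀ : InWindow lo hi (round₀ L)
        r₀ = ℤ.≤-trans lo≤L (ℤ.i≤i⊔j L (+ 0)) , ℤ.⊔-lub L≤hi 0≤hi
        r₁ : InWindow lo hi (round₁ L H)
        r₁ with H ≤? + b
        ... | yes _ = ℤ.≤-trans lo≤L (ℤ.i≤i⊔j L (- + b)) , ℤ.⊔-lub L≤hi (ℤ.≤-trans -b≤0 0≤hi)
        ... | no _ = ℤ.⊓-glb lo≤H (ℤ.≤-trans 1+j≤b b≤b+b) , ℤ.≤-trans (ℤ.i⊓j≤i H _) H≤hi
        r₂ : InWindow lo hi (round₂ H)
        r₂ = ℤ.⊓-glb lo≤H 1+j≤b , ℤ.≤-trans (ℤ.i⊓j≤i H (+ b)) H≤hi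

    rounds-window₀ : All (InWindow (+ suc j - + b) (+ j)) (rounds L H) ⇔ (+ suc j - + b ≤ℤ L × H ≤ℤ + j)
    rounds-window₀ = mk⇔ to from
      where
      lo = + suc j - + b
      hi = + j
      0≤hi : + 0 ≤ℤ hi
      0≤hi = +≤+ z≤n
      lo≰-b : ¬ (lo ≤ℤ - + b)
      lo≰-b le with Equivalence.to (-≤-⇔ (suc j) b 0 b) (subst (lo ≤ℤ_) (sym (ℤ.+-identityˡ (- + b))) le)
      ... | 1+j+b≤b = <⇒≱ (m<n+m b (s≤s z≤n)) 1+j+b≤b
      to : All (InWindow lo hi) (rounds L H) → lo ≤ℤ L × H ≤ℤ hi
      to (r₀ ∷ r₁ ∷ r₂ ∷ []) with H ≤? + b
      ... | yes H≤b = lo≤L , subst (_≤ℤ hi) (ℤ.i≤j⇒i⊓j≡i H≤b) (proj₂ r₂)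
        where
        lo≤L : lo ≤ℤ L
        lo≤L with ℤ.⊔-sel L (- + b)
        ... | inj₁ e = subst (lo ≤ℤ_) e (proj₁ r₁)
        ... | inj₂ e = ⊥-elim (lo≰-b (subst (lo ≤ℤ_) e (proj₁ r₁)))
      ... | no H≰b with ℤ.⊓-sel H (+ (b + b))
      ...   | inj₁ e = ⊥-elim (H≰b (ℤ.≤-trans (subst (_≤ℤ hi) e (proj₂ r₁)) (+≤+ (<⇒≤ j<b))))
      ...   | inj₂ e = ⊥-elim (b+b≰j (subst (_≤ℤ hi) e (proj₂ r₁)))
      from : lo ≤ℤ L × H ≤ℤ hi → All (InWindow lo hi) (rounds L H)
      from (lo≤L , H≤hi) = r₀ ∷ r₁ ∷ r₂ ∷ []
        where
        L≤hi = ℤ.≤-trans L≤H H≤hi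
        r₀ : InWindow lo hi (round₀ L)
        r₀ = ℤ.≤-trans lo≤L (ℤ.i≤i⊔j L (+ 0)) , ℤ.⊔-lub L≤hi 0≤hi
        r₁ : InWindow lo hi (round₁ L H)
        r₁ with H ≤? + b
        ... | yes _ = ℤ.≤-trans lo≤L (ℤ.i≤i⊔j L (- + b)) , ℤ.⊔-lub L≤hi (ℤ.≤-trans -b≤0 0≤hi)
        ... | no H≰b = ⊥-elim (H≰b (ℤ.≤-trans H≤hi (+≤+ (<⇒≤ j<b))))
        r₂ : InWindow lo hi (round₂ H)
        r₂ = ℤ.⊓-glb (ℤ.≤-trans lo≤L L≤H) (Equivalence.from (-≤⇔ (suc j) b b) (≤-trans j<b (m≤m+n b b))) , ℤ.≤-trans (ℤ.i⊓j≤i H (+ b)) H≤hi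

  round₀-bounds : ∀ {L} → L ≤ℤ + b → + 0 ≤ℤ round₀ L × round₀ L ≤ℤ + b
  round₀-bounds {L} L≤b = ℤ.i≤j⊔i L (+ 0) , ℤ.⊔-lub L≤b 0≤b

  round₁-bounds : ∀ {L H} → L ≤ℤ + b → + 0 ≤ℤ H → - + b ≤ℤ round₁ L H × round₁ L H ≤ℤ + (b + b)
  round₁-bounds {L} {H} L≤b 0≤H with H ≤? + b
  ... | yes _ = ℤ.i≤j⊔i L (- + b) , ℤ.≤-trans (ℤ.⊔-lub L≤b (ℤ.≤-trans -b≤0 0≤b)) b≤b+b
  ... | no _ = ℤ.⊓-glb (ℤ.≤-trans -b≤0 0≤H) (ℤ.≤-trans -b≤0 (+≤+ z≤n)) , ℤ.i⊓j≤j H (+ (b + b))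

  round₂-bounds : ∀ {H} → + 0 ≤ℤ H → + 0 ≤ℤ round₂ H × round₂ H ≤ℤ + b
  round₂-bounds {H} 0≤H = ℤ.⊓-glb 0≤H 0≤b , ℤ.i⊓j≤j H (+ b)

  round₀-mono : ∀ {L L′} → L ≤ℤ L′ → round₀ L ≤ℤ round₀ L′
  round₀-mono = ℤ.⊔-monoˡ-≤ (+ 0)

  round₂-mono : ∀ {H H′} → H ≤ℤ H′ → round₂ H ≤ℤ round₂ H′
  round₂-mono = ℤ.⊓-monoˡ-≤ (+ b)

  round₁-mono : ∀ {L L′ H H′} → L ≤ℤ + b → L ≤ℤ L′ → H ≤ℤ H′ → round₁ L H ≤ℤ round₁ L′ H′
  round₁-mono {L} {L′} {H} {H′} L≤b L≤L′ H≤H′ with H ≤? + b | H′ ≤? + b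
  ... | yes _ | yes _ = ℤ.⊔-monoˡ-≤ (- + b) L≤L′
  ... | yes _ | no H′≰b = ℤ.⊔-lub (ℤ.⊓-glb (ℤ.≤-trans L≤b (ℤ.<⇒≤ (ℤ.≰⇒> H′≰b))) (ℤ.≤-trans L≤b b≤b+b))
                                  (ℤ.⊓-glb (ℤ.≤-trans -b≤0 (ℤ.≤-trans 0≤b (ℤ.<⇒≤ (ℤ.≰⇒> H′≰b)))) (ℤ.≤-trans -b≤0 (+≤+ z≤n)))
  ... | no H≰b | yes H′≤b = ⊥-elim (H≰b (ℤ.≤-trans H≤H′ H′≤b))
  ... | no _ | no _ = ℤ.⊓-monoˡ-≤ (+ (b + b)) H≤H′

  round₀≤round₁+b : ∀ {L L′ H′} → L ≤ℤ + b → L ≤ℤ L′ +ℤ + b → + 0 ≤ℤ H′ → round₀ L ≤ℤ round₁ L′ H′ +ℤ + b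
  round₀≤round₁+b {L} {L′} {H′} L≤b L≤L′+b 0≤H′ with H′ ≤? + b
  ... | yes _ = ℤ.⊔-lub (ℤ.≤-trans L≤L′+b (ℤ.+-monoˡ-≤ (+ b) (ℤ.i≤i⊔j L′ (- + b))))
                        (subst (_≤ℤ (L′ ⊔ - + b) +ℤ + b) (ℤ.+-inverseˡ (+ b)) (ℤ.+-monoˡ-≤ (+ b) (ℤ.i≤j⊔i L′ (- + b))))
  ... | no _ = ℤ.⊔-lub (ℤ.≤-trans L≤b b≤round+b) (ℤ.≤-trans 0≤b b≤round+b)
    where
    b≤round+b : + b ≤ℤ (H′ ⊓ + (b + b)) +ℤ + b
    b≤round+b = subst (_≤ℤ (H′ ⊓ + (b + b)) +ℤ + b) (ℤ.+-identityˡ (+ b)) (ℤ.+-monoˡ-≤ (+ b) (ℤ.⊓-glb 0≤H′ (+≤+ z≤n)))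

  round₁≤round₂+b : ∀ {L H H′} → L ≤ℤ + b → H ≤ℤ H′ +ℤ + b → + 0 ≤ℤ H′ → round₁ L H ≤ℤ round₂ H′ +ℤ + b
  round₁≤round₂+b {L} {H} {H′} L≤b H≤H′+b 0≤H′ with H ≤? + b
  ... | yes _ = ℤ.≤-trans (ℤ.⊔-lub L≤b (ℤ.≤-trans -b≤0 0≤b))
                  (subst (_≤ℤ round₂ H′ +ℤ + b) (ℤ.+-identityˡ (+ b)) (ℤ.+-monoˡ-≤ (+ b) (proj₁ (round₂-bounds 0≤H′))))
  ... | no _ with ℤ.⊓-sel H′ (+ b)
  ...   | inj₁ e = subst (λ r → H ⊓ + (b + b) ≤ℤ r +ℤ + b) (sym e) (ℤ.≤-trans (ℤ.i⊓j≤i H _) H≤H′+b)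
  ...   | inj₂ e = subst (λ r → H ⊓ + (b + b) ≤ℤ r +ℤ + b) (sym e) (ℤ.i⊓j≤j H (+ (b + b)))

module _ {n : ℕ} where

  merge : ℕ → Word n → List (Fin n × ℤ) → Word n
  merge-step : (c : ℕ) → Word n → Fin n → (v : ℤ) → List (Fin n × ℤ) → Dec (v ≤ℤ + c) → Word n

  merge c β [] = β
  merge c β ((a , v) ∷ es) = merge-step c β a v es (v ≤? + c)

  merge-step c β       a v es (yes _) = a ∷ merge c β es
  merge-step c []      a v es (no _) = a ∷ merge c [] es
  merge-step c (y ∷ β) a v es (no _) = y ∷ merge (suc c) β ((a , v) ∷ es)

  count-∷ : ∀ z a (w : Word n) → count z (a ∷ w) ≡ count z (a ∷ []) + count z w
  count-∷ z a w with a ≟ z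
  ... | yes _ = refl
  ... | no _ = refl

  count-merge : ∀ z c (β : Word n) es → count z (merge c β es) ≡ count z β + count z (map proj₁ es)
  count-merge-step : ∀ z c (β : Word n) a v es d →
                     count z (merge-step c β a v es d) ≡ count z β + count z (a ∷ map proj₁ es)

  count-merge z c β [] = sym (+-identityʳ _)
  count-merge z c β ((a , v) ∷ es) = count-merge-step z c β a v es (v ≤? + c)

  count-merge-step z c β a v es (yes _) = begin
    count z (a ∷ merge c β es)                                    ≡⟨ count-∷ z a _ ⟩
    count z (a ∷ []) + count z (merge c β es)                     ≡⟨ cong (λ m → count z (a ∷ []) + m) (count-merge z c β es) ⟩
    count z (a ∷ []) + (count z β + count z (map proj₁ es))       ≡⟨ x∙yz≈y∙xz (count z (a ∷ [])) (count z β) (count z (map proj₁ es)) ⟩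
    count z β + (count z (a ∷ []) + count z (map proj₁ es))       ≡⟨ cong (λ m → count z β + m) (count-∷ z a _) ⟨
    count z β + count z (a ∷ map proj₁ es)                        ∎
    where open ≡-Reasoning
  count-merge-step z c [] a v es (no _) =
    trans (count-∷ z a _) (trans (cong (λ m → count z (a ∷ []) + m) (count-merge z c [] es)) (sym (count-∷ z a _)))
  count-merge-step z c (y ∷ β) a v es (no _) = begin
    count z (y ∷ merge (suc c) β ((a , v) ∷ es))                  ≡⟨ count-∷ z y _ ⟩
    count z (y ∷ []) + count z (merge (suc c) β ((a , v) ∷ es))   ≡⟨ cong (λ m → count z (y ∷ []) + m) (count-merge z (suc c) β ((a , v) ∷ es)) ⟩
    count z (y ∷ []) + (count z β + count z (a ∷ map proj₁ es))   ≡⟨ +-assoc (count z (y ∷ [])) _ _ ⟨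
    count z (y ∷ []) + count z β + count z (a ∷ map proj₁ es)     ≡⟨ cong (_+ count z (a ∷ map proj₁ es)) (count-∷ z y β) ⟨
    count z (y ∷ β) + count z (a ∷ map proj₁ es)                  ∎
    where open ≡-Reasoning

  module _ {P : Pred (Fin n) 0ℓ} (P? : Decidable P) where

    filter-merge-inserted : ∀ c β es → All (λ z → ¬ P z) β → filter P? (merge c β es) ≡ filter P? (map proj₁ es)
    filter-merge-inserted-step : ∀ c β a v es d → All (λ z → ¬ P z) β →
                                 filter P? (merge-step c β a v es d) ≡ filter P? (a ∷ map proj₁ es)

    filter-merge-inserted c β [] β∌P = filter-none P? β∌P
    filter-merge-inserted c β ((a , v) ∷ es) β∌P = filter-merge-inserted-step c β a v es (v ≤? + c) β∌P

    filter-merge-inserted-step c β a v es (yes _) β∌P with P? a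
    ... | yes _ = cong (a ∷_) (filter-merge-inserted c β es β∌P)
    ... | no _ = filter-merge-inserted c β es β∌P
    filter-merge-inserted-step c [] a v es (no _) β∌P with P? a
    ... | yes _ = cong (a ∷_) (filter-merge-inserted c [] es β∌P)
    ... | no _ = filter-merge-inserted c [] es β∌P
    filter-merge-inserted-step c (y ∷ β) a v es (no _) (¬Py ∷ β∌P) =
      trans (filter-reject P? ¬Py) (filter-merge-inserted (suc c) β ((a , v) ∷ es) β∌P)

    filter-merge-base : ∀ c β es → All (λ e → ¬ P (proj₁ e)) es → filter P? (merge c β es) ≡ filter P? β
    filter-merge-base-step : ∀ c β a v es d → All (λ e → ¬ P (proj₁ e)) ((a , v) ∷ es) →
                             filter P? (merge-step c β a v es d) ≡ filter P? β

    filter-merge-base c β [] _ = refl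
    filter-merge-base c β ((a , v) ∷ es) es∌P = filter-merge-base-step c β a v es (v ≤? + c) es∌P

    filter-merge-base-step c β a v es (yes _) (¬Pa ∷ es∌P) = trans (filter-reject P? ¬Pa) (filter-merge-base c β es es∌P)
    filter-merge-base-step c [] a v es (no _) (¬Pa ∷ es∌P) = trans (filter-reject P? ¬Pa) (filter-merge-base c [] es es∌P)
    filter-merge-base-step c (y ∷ β) a v es (no _) es∌P with P? y
    ... | yes _ = cong (y ∷_) (filter-merge-base (suc c) β ((a , v) ∷ es) es∌P)
    ... | no _ = filter-merge-base (suc c) β ((a , v) ∷ es) es∌P

  occurrences : Fin n → ℕ → List (Fin n × ℤ) → List (ℤ × ℕ)
  occurrences x t [] = []
  occurrences x t ((a , v) ∷ es) with a ≟ x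
  ... | yes _ = (v , t) ∷ occurrences x (suc t) es
  ... | no _ = occurrences x t es

  Placeable : Pred (Fin n) 0ℓ → ℕ → Word n → List (Fin n × ℤ) → Set
  Placeable B c β es = All (λ e → ¬ B (proj₁ e)) es × AllPairs (λ e e′ → proj₂ e ≤ℤ proj₂ e′) es ×
                       All (λ e → + c ≤ℤ proj₂ e × proj₂ e ≤ℤ + (c + length β)) es

  module _ {B : Pred (Fin n) 0ℓ} (B? : Decidable B) {x : Fin n} (x∉B : ¬ B x) where

    stamp : ℕ → ℕ → Word n → ℤ × ℕ
    stamp c t p = + (c + length (filter B? p)) , t + count x p

    private
      emit-inserted : ∀ c t a v es (m : Word n) → ¬ B a → v ≡ + c →
                      (∀ t′ → map (stamp c t′) (prefixesBefore x m) ≡ occurrences x t′ es) →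
                      map (stamp c t) (prefixesBefore x (a ∷ m)) ≡ occurrences x t ((a , v) ∷ es)
      emit-inserted c t a v es m a∉B v≡c rest with a ≟ x
      ... | yes refl = cong₂ _∷_ (cong₂ _,_ (trans (cong +_ (+-identityʳ c)) (sym v≡c)) (+-identityʳ t))
                         (trans (sym (map-∘ (prefixesBefore a m))) (trans (map-cong shift (prefixesBefore a m)) (rest (suc t))))
        where
        shift : ∀ p → stamp c t (a ∷ p) ≡ stamp c (suc t) p
        shift p = cong₂ _,_ (cong (λ q → + (c + length q)) (filter-reject B? a∉B))
                            (trans (cong (λ k → t + k) (count-∷-≡ a p)) (+-suc t _))
      ... | no a≢x = trans (sym (map-∘ (prefixesBefore x m))) (trans (map-cong shift (prefixesBefore x m)) (rest t))
        where
        shift : ∀ p → stamp c t (a ∷ p) ≡ stamp c t p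
        shift p = cong₂ _,_ (cong (λ q → + (c + length q)) (filter-reject B? a∉B)) (cong (λ k → t + k) (count-∷-≢ p a≢x))

      emit-base : ∀ c t y (m : Word n) → B y → map (stamp c t) (prefixesBefore x (y ∷ m)) ≡ map (stamp (suc c) t) (prefixesBefore x m)
      emit-base c t y m y∈B = trans (cong (map (stamp c t)) (prefixesBefore-∷-≢ m y≢x)) (trans (sym (map-∘ (prefixesBefore x m))) (map-cong shift (prefixesBefore x m)))
        where
        y≢x : y ≢ x
        y≢x refl = x∉B y∈B
        shift : ∀ p → stamp c t (y ∷ p) ≡ stamp (suc c) t p
        shift p = cong₂ _,_ (cong +_ (trans (cong (λ q → c + length q) (filter-accept B? y∈B)) (+-suc c _))) (cong (λ k → t + k) (count-∷-≢ p y≢x))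

    prefixesBefore-merge : ∀ c t β es → All B β → Placeable B c β es →
                           map (stamp c t) (prefixesBefore x (merge c β es)) ≡ occurrences x t es
    prefixesBefore-merge-step : ∀ c t β a v es d → All B β → Placeable B c β ((a , v) ∷ es) →
                                map (stamp c t) (prefixesBefore x (merge-step c β a v es d)) ≡ occurrences x t ((a , v) ∷ es)

    prefixesBefore-merge c t β [] β⊆B _ = cong (map (stamp c t)) (prefixesBefore-absent x β (count-absent β β⊆B))
      where
      count-absent : ∀ w → All B w → count x w ≡ 0
      count-absent [] [] = refl
      count-absent (y ∷ w) (y∈B ∷ w⊆B) = trans (count-∷-≢ {a = y} w (λ { refl → x∉B y∈B })) (count-absent w w⊆B)
    prefixesBefore-merge c t β ((a , v) ∷ es) β⊆B placeable = prefixesBefore-merge-step c t β a v es (v ≤? + c) β⊆B placeable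

    prefixesBefore-merge-step c t β a v es (yes v≤c) β⊆B (a∉B ∷ es∌B , _ ∷ sorted , (c≤v , _) ∷ bounds) =
      emit-inserted c t a v es (merge c β es) a∉B (ℤ.≤-antisym v≤c c≤v) (λ t′ → prefixesBefore-merge c t′ β es β⊆B (es∌B , sorted , bounds))
    prefixesBefore-merge-step c t [] a v es (no v≰c) _ (_ , _ , (_ , v≤c+0) ∷ _) =
      ⊥-elim (v≰c (subst (v ≤ℤ_) (cong +_ (+-identityʳ c)) v≤c+0))
    prefixesBefore-merge-step c t (y ∷ β) a v es (no v≰c) (y∈B ∷ β⊆B) (es∌B , sorted , bounds) =
      trans (emit-base c t y (merge (suc c) β ((a , v) ∷ es)) y∈B) (prefixesBefore-merge (suc c) t β ((a , v) ∷ es) β⊆B (es∌B , sorted , shifted sorted bounds))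
      where
      c<v : + suc c ≤ℤ v
      c<v = ℤ.i<j⇒suc[i]≤j (ℤ.≰⇒> v≰c)
      shifted : ∀ {es′} → AllPairs (λ e e′ → proj₂ e ≤ℤ proj₂ e′) ((a , v) ∷ es′) →
                All (λ e → + c ≤ℤ proj₂ e × proj₂ e ≤ℤ + (c + suc (length β))) ((a , v) ∷ es′) →
                All (λ e → + suc c ≤ℤ proj₂ e × proj₂ e ≤ℤ + (suc c + length β)) ((a , v) ∷ es′)
      shifted (v≤ ∷ _) ((_ , v≤top) ∷ bounds) = (c<v , subst (v ≤ℤ_) (cong +_ (+-suc c (length β))) v≤top)
        ∷ shift v≤ bounds
        where
        shift : ∀ {es″} → All (λ e → v ≤ℤ proj₂ e) es″ → All (λ e → + c ≤ℤ proj₂ e × proj₂ e ≤ℤ + (c + suc (length β))) es″ →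
                All (λ e → + suc c ≤ℤ proj₂ e × proj₂ e ≤ℤ + (suc c + length β)) es″
        shift [] [] = []
        shift {e ∷ _} (v≤v′ ∷ v≤) ((_ , v′≤top) ∷ bounds) =
          (ℤ.≤-trans c<v v≤v′ , subst (proj₂ e ≤ℤ_) (cong +_ (+-suc c (length β))) v′≤top) ∷ shift v≤ bounds

  keyed : (Fin n → ℤ) → Word n → List (Fin n × ℤ)
  keyed f = map (λ z → z , f z)

  letters-keyed : ∀ f (l : Word n) → map proj₁ (keyed f l) ≡ l
  letters-keyed f [] = refl
  letters-keyed f (a ∷ l) = cong (a ∷_) (letters-keyed f l)

  occurrences-++ : ∀ x t (l₁ l₂ : List (Fin n × ℤ)) →
                   occurrences x t (l₁ ++ l₂) ≡ occurrences x t l₁ ++ occurrences x (t + count x (map proj₁ l₁)) l₂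
  occurrences-++ x t [] l₂ = cong (λ t′ → occurrences x t′ l₂) (sym (+-identityʳ t))
  occurrences-++ x t ((a , v) ∷ l₁) l₂ with a ≟ x
  ... | yes _ = cong ((v , t) ∷_) (trans (occurrences-++ x (suc t) l₁ l₂) (cong (λ t′ → occurrences x (suc t) l₁ ++ occurrences x t′ l₂) (sym (+-suc t _))))
  ... | no _ = occurrences-++ x t l₁ l₂

  occurrences-absent : ∀ x t f (l : Word n) → count x l ≡ 0 → occurrences x t (keyed f l) ≡ []
  occurrences-absent x t f [] _ = refl
  occurrences-absent x t f (a ∷ l) cx≡0 with a ≟ x | cx≡0
  ... | yes _ | ()
  ... | no _ | cx≡0′ = occurrences-absent x t f l cx≡0′

  occurrences-once : ∀ x t f (l : Word n) → count x l ≡ 1 → occurrences x t (keyed f l) ≡ (f x , t) ∷ []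
  occurrences-once x t f (a ∷ l) cx≡1 with a ≟ x | cx≡1
  ... | yes refl | cx≡1′ = cong ((f a , t) ∷_) (occurrences-absent x (suc t) f l (suc-injective cx≡1′))
  ... | no _ | cx≡1′ = occurrences-once x t f l cx≡1′

module CoBipartiteConstruction {n : ℕ} (G : Graph n) (side : Fin n → Bool)
  (same-side⇒Adj : ∀ x y → x ≢ y → side x ≡ side y → Adj G x y)
  (k : ℕ) (u : Word n) (uniform : ∀ v → count v u ≡ suc k)
  (u-represents : ∀ x y → x ≢ y → Alternate x y u ⇔ Adj G x y) where

  B : Fin n → Set
  B y = side y ≡ true

  B? : Decidable B
  B? y = side y Bool.≟ true

  private
    same-side : ∀ {x y} → ¬ B x → ¬ B y → side x ≡ side y
    same-side {x} {y} x∉B y∉B with side x | side y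
    ... | true | _ = ⊥-elim (x∉B refl)
    ... | false | true = ⊥-elim (y∉B refl)
    ... | false | false = refl

  B-alternate : ∀ y y′ → B y → B y′ → y ≢ y′ → Alternate y y′ u
  B-alternate y y′ y∈B y′∈B y≢y′ = Equivalence.from (u-represents y y′ y≢y′) (same-side⇒Adj y y′ y≢y′ (trans y∈B (sym y′∈B)))

  A-alternate : ∀ x x′ → ¬ B x → ¬ B x′ → x ≢ x′ → Alternate x x′ u
  A-alternate x x′ x∉B x′∉B x≢x′ = Equivalence.from (u-represents x x′ x≢x′) (same-side⇒Adj x x′ x≢x′ (same-side x∉B x′∉B))

  open Profiles B? u B-alternate A-alternate k uniform
  open Rounds b

  u-covers : ∀ v → v ∈ u
  u-covers v = count>0⇒∈ u (subst (0 <_) (sym (uniform v)) (s≤s z≤n))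

  πA πB : Word n
  πA = filter (¬? ∘ B?) (initialPermutation u)
  πB = filter B? (initialPermutation u)

  count-πA-∉ : ∀ {v} → ¬ B v → count v πA ≡ 1
  count-πA-∉ v∉B = trans (count-filter-accept (¬? ∘ B?) (initialPermutation u) v∉B) (count-initialPermutation u (u-covers _))

  count-πA-∈ : ∀ {v} → B v → count v πA ≡ 0
  count-πA-∈ v∈B = count-filter-reject (¬? ∘ B?) (initialPermutation u) (λ v∉B → v∉B v∈B)

  count-πB-∈ : ∀ {v} → B v → count v πB ≡ 1
  count-πB-∈ v∈B = trans (count-filter-accept B? (initialPermutation u) v∈B) (count-initialPermutation u (u-covers _))

  count-πB-∉ : ∀ {v} → ¬ B v → count v πB ≡ 0
  count-πB-∉ v∉B = count-filter-reject B? (initialPermutation u) v∉B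

  length-πB : length πB ≡ b
  length-πB = trans (length-filter-sum B? (initialPermutation u))
    (sum-cong-≗ (λ v → trans (cong (indicator (B? v) *_) (count-initialPermutation u (u-covers v))) (*-identityʳ _)))

  offset₀ offset₁ offset₂ : Fin n → ℤ
  offset₀ x = round₀ (low x)
  offset₁ x = round₁ (low x) (high x) +ℤ + b
  offset₂ x = round₂ (high x) +ℤ + (b + b)

  entries : List (Fin n × ℤ)
  entries = keyed offset₀ πA ++ keyed offset₁ πA ++ keyed offset₂ πA

  πA-in-A : All (λ z → ¬ B z) πA
  πA-in-A = All.all-filter (¬? ∘ B?) (initialPermutation u)

  πB-in-B : All B πB
  πB-in-B = All.all-filter B? (initialPermutation u)

  entries-in-A : All (λ e → ¬ B (proj₁ e)) entries
  entries-in-A = All.++⁺ (keyed-in-A offset₀) (All.++⁺ (keyed-in-A offset₁) (keyed-in-A offset₂))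
    where
    keyed-in-A : ∀ f → All (λ e → ¬ B (proj₁ e)) (keyed f πA)
    keyed-in-A f = All.map⁺ πA-in-A

  thrice : Word n → Word n
  thrice l = l ++ l ++ l

  β : Word n
  β = thrice πB

  w′ : Word n
  w′ = merge 0 β entries

  letters-entries : map proj₁ entries ≡ thrice πA
  letters-entries = begin
    map proj₁ entries  ≡⟨ map-++ proj₁ (keyed offset₀ πA) _ ⟩
    map proj₁ (keyed offset₀ πA) ++ map proj₁ (keyed offset₁ πA ++ keyed offset₂ πA)
                       ≡⟨ cong₂ _++_ (letters-keyed offset₀ πA) (trans (map-++ proj₁ (keyed offset₁ πA) _) (cong₂ _++_ (letters-keyed offset₁ πA) (letters-keyed offset₂ πA))) ⟩
    thrice πA          ∎
    where open ≡-Reasoning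

  count-thrice : ∀ v l → count v (thrice l) ≡ count v l + (count v l + count v l)
  count-thrice v l = trans (count-++ v l (l ++ l)) (cong (λ m → count v l + m) (count-++ v l l))

  w′-uniform : ∀ v → count v w′ ≡ 3
  w′-uniform v = begin
    count v w′                                  ≡⟨ count-merge v 0 β entries ⟩
    count v β + count v (map proj₁ entries)     ≡⟨ cong₂ _+_ (count-thrice v πB) (trans (cong (count v) letters-entries) (count-thrice v πA)) ⟩
    count v πB + (count v πB + count v πB) + (count v πA + (count v πA + count v πA))  ≡⟨ by-side (B? v) ⟩
    3                                           ∎
    where
    open ≡-Reasoning
    by-side : Dec (B v) → count v πB + (count v πB + count v πB) + (count v πA + (count v πA + count v πA)) ≡ 3
    by-side (yes v∈B) rewrite count-πB-∈ v∈B | count-πA-∈ v∈B = refl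
    by-side (no v∉B) rewrite count-πB-∉ v∉B | count-πA-∉ v∉B = refl

  restrict-thrice : ∀ x y l → restrict x y (thrice l) ≡ thrice (restrict x y l)
  restrict-thrice x y l = trans (restrict-++ x y l (l ++ l)) (cong (restrict x y l ++_) (restrict-++ x y l l))

  private
    thrice-alternating : ∀ {a c : Fin n} → a ≢ c → NoAdjRepeat (thrice (a ∷ c ∷ []))
    thrice-alternating {a} {c} a≢c = cons a c _ a≢c (cons c a _ c≢a (cons a c _ a≢c (cons c a _ c≢a (cons a c _ a≢c (one c)))))
      where c≢a = ≢-sym a≢c

    initial-pair : ∀ {x y} → x ≢ y → NoAdjRepeat (thrice (restrict x y (initialPermutation u))) ×
                                      head (thrice (restrict x y (initialPermutation u))) ≡ first x y u
    initial-pair {x} {y} x≢y with restrict x y (initialPermutation u) in eq | restrict-initialPermutation u x≢y (u-covers x) (u-covers y)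
    ... | _ | inj₁ refl = thrice-alternating x≢y , trans (cong head (sym eq)) (first-initialPermutation x y u)
    ... | _ | inj₂ refl = thrice-alternating (≢-sym x≢y) , trans (cong head (sym eq)) (first-initialPermutation x y u)

  restrict-w′-B : ∀ {y y′} → B y → B y′ → restrict y y′ w′ ≡ thrice (restrict y y′ (initialPermutation u))
  restrict-w′-B {y} {y′} y∈B y′∈B = begin
    restrict y y′ w′                               ≡⟨ filter-merge-base (λ z → (z ≟ y) ⊎-dec (z ≟ y′)) 0 β entries entries∌y,y′ ⟩
    restrict y y′ (thrice πB)                      ≡⟨ restrict-thrice y y′ πB ⟩
    thrice (restrict y y′ πB)                      ≡⟨ cong thrice (restrict-filter B? (initialPermutation u) y∈B y′∈B) ⟩
    thrice (restrict y y′ (initialPermutation u))  ∎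
    where
    open ≡-Reasoning
    entries∌y,y′ : All (λ e → ¬ (proj₁ e ≡ y ⊎ proj₁ e ≡ y′)) entries
    entries∌y,y′ = All.map (λ { a∉B (inj₁ refl) → a∉B y∈B ; a∉B (inj₂ refl) → a∉B y′∈B }) entries-in-A

  restrict-w′-A : ∀ {x x′} → ¬ B x → ¬ B x′ → restrict x x′ w′ ≡ thrice (restrict x x′ (initialPermutation u))
  restrict-w′-A {x} {x′} x∉B x′∉B = begin
    restrict x x′ w′                               ≡⟨ filter-merge-inserted (λ z → (z ≟ x) ⊎-dec (z ≟ x′)) 0 β entries β∌x,x′ ⟩
    restrict x x′ (map proj₁ entries)              ≡⟨ cong (restrict x x′) letters-entries ⟩
    restrict x x′ (thrice πA)                      ≡⟨ restrict-thrice x x′ πA ⟩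
    thrice (restrict x x′ πA)                      ≡⟨ cong thrice (restrict-filter (¬? ∘ B?) (initialPermutation u) x∉B x′∉B) ⟩
    thrice (restrict x x′ (initialPermutation u))  ∎
    where
    open ≡-Reasoning
    β∌x,x′ : All (λ z → ¬ (z ≡ x ⊎ z ≡ x′)) β
    β∌x,x′ = All.map (λ { y∈B (inj₁ refl) → x∉B y∈B ; y∈B (inj₂ refl) → x′∉B y∈B }) (All.++⁺ πB-in-B (All.++⁺ πB-in-B πB-in-B))

  w′-B-alternate : ∀ y y′ → B y → B y′ → y ≢ y′ → Alternate y y′ w′
  w′-B-alternate y y′ y∈B y′∈B y≢y′ = subst NoAdjRepeat (sym (restrict-w′-B y∈B y′∈B)) (proj₁ (initial-pair y≢y′))

  w′-A-alternate : ∀ x x′ → ¬ B x → ¬ B x′ → x ≢ x′ → Alternate x x′ w′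
  w′-A-alternate x x′ x∉B x′∉B x≢x′ = subst NoAdjRepeat (sym (restrict-w′-A x∉B x′∉B)) (proj₁ (initial-pair x≢x′))

  first-w′-B : ∀ {y y′} → B y → B y′ → y ≢ y′ → first y y′ w′ ≡ first y y′ u
  first-w′-B y∈B y′∈B y≢y′ = trans (cong head (restrict-w′-B y∈B y′∈B)) (proj₂ (initial-pair y≢y′))

  module W′ = Window B? w′ w′-B-alternate

  rank-w′ : ∀ {y} → B y → W′.rank y ≡ rank y
  rank-w′ {y} y∈B = sum-cong-≗ same-precedence
    where
    same-precedence : ∀ y′ → indicator (W′.precedes? y′ y) ≡ indicator (precedes? y′ y)
    same-precedence y′ with B? y′ | y′ ≟ y
    ... | no _ | _ = refl
    ... | yes _ | yes _ = refl
    ... | yes y′∈B | no y′≢y rewrite first-w′-B y′∈B y∈B y′≢y = refl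

  private
    3b : ℕ
    3b = b + (b + b)

    offset₀-bounds : ∀ z → + 0 ≤ℤ offset₀ z × offset₀ z ≤ℤ + 3b
    offset₀-bounds z with round₀-bounds (low≤b z)
    ... | 0≤r , r≤b = 0≤r , ℤ.≤-trans r≤b (+≤+ (m≤m+n b _))

    offset₁-bounds : ∀ z → + 0 ≤ℤ offset₁ z × offset₁ z ≤ℤ + 3b
    offset₁-bounds z with round₁-bounds (low≤b z) (0≤high z)
    ... | -b≤r , r≤2b = subst (_≤ℤ offset₁ z) (ℤ.+-inverseˡ (+ b)) (ℤ.+-monoˡ-≤ (+ b) -b≤r) ,
                       subst (offset₁ z ≤ℤ_) (cong +_ (+-comm (b + b) b)) (ℤ.+-monoˡ-≤ (+ b) r≤2b)

    offset₂-bounds : ∀ z → + 0 ≤ℤ offset₂ z × offset₂ z ≤ℤ + 3b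
    offset₂-bounds z with round₂-bounds (0≤high z)
    ... | 0≤r , r≤b = ℤ.≤-trans 0≤r (ℤ.i≤i+j _ (+ (b + b))) , ℤ.+-monoˡ-≤ (+ (b + b)) r≤b

  length-β : length β ≡ 3b
  length-β = trans (length-++ πB) (cong₂ _+_ length-πB (trans (length-++ πB) (cong₂ _+_ length-πB length-πB)))

  private
    ordered-πA : AllPairs (λ z z′ → ¬ B z × ¬ B z′ × z ≢ z′ × first z z′ u ≡ just z) πA
    ordered-πA = AllPairs-All πA-in-A (AllPairs.filter⁺ (¬? ∘ B?) (initialPermutation-ordered u))

    Sorted : List (Fin n × ℤ) → Set
    Sorted = AllPairs (λ e e′ → proj₂ e ≤ℤ proj₂ e′)

    sorted-round : ∀ f → (∀ {z z′} → ¬ B z → ¬ B z′ → low z ≤ℤ low z′ → high z ≤ℤ high z′ → f z ≤ℤ f z′) → Sorted (keyed f πA)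
    sorted-round f mono = AllPairs.map⁺ (AllPairs.map
      (λ (z∉B , z′∉B , z≢z′ , z-first) → mono z∉B z′∉B (low-ordered z∉B z′∉B z≢z′ z-first) (high-ordered z∉B z′∉B z≢z′ z-first))
      ordered-πA)

    across : ∀ f g → (∀ {z z′} → ¬ B z → ¬ B z′ → f z ≤ℤ g z′) → All (λ e → All (λ e′ → proj₂ e ≤ℤ proj₂ e′) (keyed g πA)) (keyed f πA)
    across f g f≤g = All.map⁺ (All.map (λ z∉B → All.map⁺ (All.map (λ z′∉B → f≤g z∉B z′∉B) πA-in-A)) πA-in-A)

  entries-sorted : Sorted entries
  entries-sorted = AllPairs.++⁺ sorted₀ (AllPairs.++⁺ sorted₁ sorted₂ (across offset₁ offset₂ offset₁≤offset₂))
                     (All.zipWith (λ (≤₁ , ≤₂) → All.++⁺ ≤₁ ≤₂) (across offset₀ offset₁ offset₀≤offset₁ , across offset₀ offset₂ offset₀≤offset₂))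
    where
    sorted₀ = sorted-round offset₀ (λ _ _ low≤ _ → round₀-mono low≤)
    sorted₁ = sorted-round offset₁ (λ {z} _ _ low≤ high≤ → ℤ.+-monoˡ-≤ (+ b) (round₁-mono (low≤b z) low≤ high≤))
    sorted₂ = sorted-round offset₂ (λ _ _ _ high≤ → ℤ.+-monoˡ-≤ (+ (b + b)) (round₂-mono high≤))
    offset₀≤offset₁ : ∀ {z z′} → ¬ B z → ¬ B z′ → offset₀ z ≤ℤ offset₁ z′
    offset₀≤offset₁ {z} {z′} z∉B z′∉B = round₀≤round₁+b (low≤b z) (low-step z′∉B z∉B) (0≤high z′)
    offset₁≤offset₂ : ∀ {z z′} → ¬ B z → ¬ B z′ → offset₁ z ≤ℤ offset₂ z′
    offset₁≤offset₂ {z} {z′} z∉B z′∉B = subst (offset₁ z ≤ℤ_) (ℤ.+-assoc (round₂ (high z′)) (+ b) (+ b))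
      (ℤ.+-monoˡ-≤ (+ b) (round₁≤round₂+b (low≤b z) (high-step z′∉B z∉B) (0≤high z′)))
    offset₀≤offset₂ : ∀ {z z′} → ¬ B z → ¬ B z′ → offset₀ z ≤ℤ offset₂ z′
    offset₀≤offset₂ {z} {z′} _ _ = ℤ.≤-trans (proj₂ (round₀-bounds (low≤b z)))
      (subst (_≤ℤ offset₂ z′) (ℤ.+-identityˡ (+ b)) (ℤ.+-mono-≤ (proj₁ (round₂-bounds (0≤high z′))) (+≤+ (m≤m+n b b))))

  entries-placeable : Placeable B 0 β entries
  entries-placeable = entries-in-A , entries-sorted ,
    subst (λ m → All (λ e → + 0 ≤ℤ proj₂ e × proj₂ e ≤ℤ + m) entries) (sym length-β)
      (All.++⁺ (keyed-bounds offset₀ offset₀-bounds) (All.++⁺ (keyed-bounds offset₁ offset₁-bounds) (keyed-bounds offset₂ offset₂-bounds)))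
    where
    keyed-bounds : ∀ f → (∀ z → + 0 ≤ℤ f z × f z ≤ℤ + 3b) → All (λ e → + 0 ≤ℤ proj₂ e × proj₂ e ≤ℤ + 3b) (keyed f πA)
    keyed-bounds f bounds = All.map⁺ (All.tabulate (λ {z} _ → bounds z))

  occurrences-entries : ∀ {x} → ¬ B x → occurrences x 0 entries ≡ (offset₀ x , 0) ∷ (offset₁ x , 1) ∷ (offset₂ x , 2) ∷ []
  occurrences-entries {x} x∉B = begin
    occurrences x 0 entries
      ≡⟨ occurrences-++ x 0 (keyed offset₀ πA) _ ⟩
    occurrences x 0 (keyed offset₀ πA) ++ occurrences x (0 + count x (map proj₁ (keyed offset₀ πA))) (keyed offset₁ πA ++ keyed offset₂ πA)
      ≡⟨ cong₂ _++_ (occurrences-once x 0 offset₀ πA once) (cong (λ t → occurrences x t (keyed offset₁ πA ++ keyed offset₂ πA)) (shift offset₀)) ⟩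
    (offset₀ x , 0) ∷ occurrences x 1 (keyed offset₁ πA ++ keyed offset₂ πA)
      ≡⟨ cong ((offset₀ x , 0) ∷_) (occurrences-++ x 1 (keyed offset₁ πA) _) ⟩
    (offset₀ x , 0) ∷ occurrences x 1 (keyed offset₁ πA) ++ occurrences x (1 + count x (map proj₁ (keyed offset₁ πA))) (keyed offset₂ πA)
      ≡⟨ cong ((offset₀ x , 0) ∷_) (cong₂ _++_ (occurrences-once x 1 offset₁ πA once) (cong (λ t → occurrences x t (keyed offset₂ πA)) (cong suc (shift offset₁)))) ⟩
    (offset₀ x , 0) ∷ (offset₁ x , 1) ∷ occurrences x 2 (keyed offset₂ πA)
      ≡⟨ cong (λ l → (offset₀ x , 0) ∷ (offset₁ x , 1) ∷ l) (occurrences-once x 2 offset₂ πA once) ⟩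
    (offset₀ x , 0) ∷ (offset₁ x , 1) ∷ (offset₂ x , 2) ∷ []  ∎
    where
    open ≡-Reasoning
    once : count x πA ≡ 1
    once = count-πA-∉ x∉B
    shift : ∀ f → count x (map proj₁ (keyed f πA)) ≡ 1
    shift f = trans (cong (count x) (letters-keyed f πA)) once

  profile-w′ : ∀ {x} → ¬ B x → W′.profile x ≡ rounds (low x) (high x)
  profile-w′ {x} x∉B = begin
    W′.profile x                                                       ≡⟨ map-∘ (prefixesBefore x w′) ⟩
    map relative (map (stamp B? x∉B 0 0) (prefixesBefore x w′))        ≡⟨ cong (map relative) (prefixesBefore-merge B? x∉B 0 0 β entries β-in-B entries-placeable) ⟩
    map relative (occurrences x 0 entries)                              ≡⟨ cong (map relative) (occurrences-entries x∉B) ⟩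
    offset₀ x - + (b * 0) ∷ offset₁ x - + (b * 1) ∷ offset₂ x - + (b * 2) ∷ []
                                                                        ≡⟨ cong₂ _∷_ (cancel₀ (round₀ (low x))) (cong₂ _∷_ (cancel₁ (round₁ (low x) (high x))) (cong (_∷ []) (cancel₂ (round₂ (high x))))) ⟩
    rounds (low x) (high x)                                             ∎
    where
    open ≡-Reasoning
    relative : ℤ × ℕ → ℤ
    relative (v , t) = v - + (b * t)
    β-in-B : All B β
    β-in-B = All.++⁺ πB-in-B (All.++⁺ πB-in-B πB-in-B)
    +-cancel : ∀ X M → (X +ℤ M) - M ≡ X
    +-cancel = ℤ-Solver.solve-∀
    cancel₀ : ∀ X → X - + (b * 0) ≡ X
    cancel₀ X = trans (cong (λ m → X - + m) (*-zeroʳ b)) (ℤ.+-identityʳ X)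
    cancel₁ : ∀ X → (X +ℤ + b) - + (b * 1) ≡ X
    cancel₁ X = trans (cong (λ m → (X +ℤ + b) - + m) (*-identityʳ b)) (+-cancel X (+ b))
    cancel₂ : ∀ X → (X +ℤ + (b + b)) - + (b * 2) ≡ X
    cancel₂ X = trans (cong (λ m → (X +ℤ + (b + b)) - + m) (trans (*-comm b 2) (cong (λ m → b + m) (+-identityʳ b)))) (+-cancel X (+ (b + b)))

  rounds⇔profile : ∀ {j} x → j < b → Window j (rounds (low x) (high x)) ⇔ Window j (profile x)
  rounds⇔profile {j} x j<b =
    ⇔.trans (rounds-window₁ j<b (low≤high x)) (⇔.sym (window-profile x (+≤+ j<b) (+≤+ z≤n))) ⊎-⇔
    ⇔.trans (rounds-window₀ j<b (low≤high x)) (⇔.sym (window-profile x (Equivalence.from (-≤⇔ (suc j) b b) (≤-trans j<b (m≤m+n b b))) (+≤+ z≤n)))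

  w′-AB : ∀ {x y} → ¬ B x → B y → Alternate x y w′ ⇔ Adj G x y
  w′-AB {x} {y} x∉B y∈B = begin
    Alternate x y w′                               ≈⟨ W′.alternate⇔Window x∉B y∈B (trans (w′-uniform x) (sym (w′-uniform y))) ⟩
    W′.Window (W′.rank y) (W′.profile x)           ≡⟨ cong₂ Window (rank-w′ y∈B) (profile-w′ x∉B) ⟩
    Window (rank y) (rounds (low x) (high x))      ≈⟨ rounds⇔profile x (rank<b y∈B) ⟩
    Window (rank y) (profile x)                    ≈⟨ alternate⇔Window x∉B y∈B (trans (uniform x) (sym (uniform y))) ⟨
    Alternate x y u                                ≈⟨ u-represents x y (λ { refl → x∉B y∈B }) ⟩
    Adj G x y                                      ∎
    where open import Relation.Binary.Reasoning.Setoid (⇔.⇔-setoid 0ℓ)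

  w′-represents : ∀ x y → x ≢ y → Alternate x y w′ ⇔ Adj G x y
  w′-represents x y x≢y with B? x | B? y
  ... | yes x∈B | yes y∈B = mk⇔ (λ _ → same-side⇒Adj x y x≢y (trans x∈B (sym y∈B))) (λ _ → w′-B-alternate x y x∈B y∈B x≢y)
  ... | no x∉B | no y∉B = mk⇔ (λ _ → same-side⇒Adj x y x≢y (same-side x∉B y∉B)) (λ _ → w′-A-alternate x y x∉B y∉B x≢y)
  ... | no x∉B | yes y∈B = w′-AB x∉B y∈B
  ... | yes x∈B | no y∉B = mk⇔
    (λ alt → Graph.sym G y x (Equivalence.to (w′-AB y∉B x∈B) (Alternate-sym x y w′ alt)))
    (λ adj → Alternate-sym y x w′ (Equivalence.from (w′-AB y∉B x∈B) (Graph.sym G x y adj)))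

  w′-representation : KRepresentable 3 G
  w′-representation = w′ , w′-uniform , (λ v → count>0⇒∈ w′ (subst (0 <_) (sym (w′-uniform v)) (s≤s z≤n))) , w′-represents

cobipartite⇒3-representable : ∀ {n} (G : Graph n) → CoBipartite G → ∀ k → KRepresentable (suc k) G → KRepresentable 3 G
cobipartite⇒3-representable G (side , same-side⇒Adj) k (u , uniform , _ , represents) =
  CoBipartiteConstruction.w′-representation G side same-side⇒Adj k u uniform represents

mainTheorem2 : ∀ (n : ℕ) (G : Graph n) → WordRepresentable G → CoBipartite G → KRepresentable 3 G
mainTheorem2 zero G _ _ = [] , (λ ()) , (λ ()) , (λ ())
mainTheorem2 (suc n) G (w , w-represents) cobipartite with uniformise {G = G} w w-represents
... | zero , u , uniform , covers , _ = ⊥-elim (<-irrefl refl (subst (0 <_) (uniform Fin.zero) (∈⇒count>0 (covers Fin.zero))))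
... | suc k , representation = cobipartite⇒3-representable G cobipartite k representation
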